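{- Let $r\ge2$ and let $g$ be an oriented two-graph on $r$ vertices with the property that for every oriented two-graph $h$ on a vertex set $V$ with $|V|=r+1$, $$|\{A\subset V\mid h|_A\cong g\}|\le 2.$$ Then $$\frac{r!}{|\operatorname{Aut}(g)|\,2^{\binom{r-1}{2}}}\le\pi(\mathcal{H}(r)).$$
   Context: An oriented two-graph on a finite set $V$ is an alternating function $g$ (swapping two arguments changes the sign) from ordered triples of distinct elements of $V$ to $\{\pm1\}$ with $g(x,y,z)g(y,x,w)g(z,y,w)g(x,z,w)=+1$ for all distinct $x,y,z,w$. For $A\subseteq V$, $h|_A$ is the restriction of $h$ to triples from $A$. Oriented two-graphs $h$ on $W$ and $g$ on $V$ are isomorphic if there is a bijection $\phi:W\to V$ with $g(\phi x,\phi y,\phi z)=h(x,y,z)$. $\operatorname{Aut}(g)$ is the group of permutations $\sigma$ with $g(\sigma x,\sigma y,\sigma z)=g(x,y,z)$. $\mathcal{H}(r)$ is the $r$-uniform hypergraph on $r+1$ vertices with $3$ edges, and $\pi(\mathcal{H})=\lim_{n\to\infty}\operatorname{ex}(\mathcal{H},n)\binom{n}{r}^{ -1}$ is the Turán density, where $\operatorname{ex}(\mathcal{H},n)$ is the maximum number of edges of an $r$-graph on $n$ vertices with no copy of $\mathcal{H}$. -}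

module Defs where

open import Data.Nat using (ℕ; zero; suc; _+_; _*_; _^_; _≤_; _!)
open import Data.Nat.Combinatorics using (_C_)
open import Data.Bool using (Bool; true; false)
import Data.Bool.Properties as BoolP
open import Data.Fin using (Fin)
open import Data.Fin.Properties using (all?) renaming (_≟_ to _≟ᶠ_)
open import Data.Fin.Subset using (Subset; _∈_; ∣_∣)
open import Data.Vec using (Vec; []; _∷_; lookup)
open import Data.List using (List; []; _∷_; [_]; length; filter; concatMap; allFin; map)
open import Data.Sign using (Sign; opposite) renaming (_*_ to _·_)
import Data.Sign.Properties as SignP
open import Data.Product using (Σ; ∃; _×_; _,_)
open import Relation.Binary.PropositionalEquality using (_≡_; _≢_)
open import Relation.Nullary using (Dec; ¬_)
open import Relation.Nullary.Decidable using (_×-dec_; _→-dec_; ¬?)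
open import Function.Bundles using (_⇔_)

-- Oriented two-graphs on the vertex set Fin n.
-- Values on triples with a repeated vertex are irrelevant: every
-- condition below only ever inspects triples of distinct vertices.

Distinct3 : ∀ {n} → Fin n → Fin n → Fin n → Set
Distinct3 x y z = x ≢ y × y ≢ z × x ≢ z

Distinct4 : ∀ {n} → Fin n → Fin n → Fin n → Fin n → Set
Distinct4 x y z w = Distinct3 x y z × x ≢ w × y ≢ w × z ≢ w

record OrientedTwoGraph (n : ℕ) : Set where
  field
    g : Fin n → Fin n → Fin n → Sign
    swap₁₂ : ∀ x y z → Distinct3 x y z → g y x z ≡ opposite (g x y z)
    swap₂₃ : ∀ x y z → Distinct3 x y z → g x z y ≡ opposite (g x y z)
    swap₁₃ : ∀ x y z → Distinct3 x y z → g z y x ≡ opposite (g x y z)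
    cocycle : ∀ x y z w → Distinct4 x y z w →
              ((g x y z · g y x w) · g z y w) · g x z w ≡ Sign.+

open OrientedTwoGraph public

IsAut : ∀ {r} → OrientedTwoGraph r → Vec (Fin r) r → Set
IsAut {r} G σ =
  (∀ i j → lookup σ i ≡ lookup σ j → i ≡ j) ×
  (∀ x y z → Distinct3 x y z →
     g G (lookup σ x) (lookup σ y) (lookup σ z) ≡ g G x y z)

isAut? : ∀ {r} (G : OrientedTwoGraph r) (σ : Vec (Fin r) r) → Dec (IsAut G σ)
isAut? G σ =
  all? (λ i → all? (λ j → (lookup σ i ≟ᶠ lookup σ j) →-dec (i ≟ᶠ j)))
  ×-dec
  all? (λ x → all? (λ y → all? (λ z →
    (¬? (x ≟ᶠ y) ×-dec (¬? (y ≟ᶠ z) ×-dec ¬? (x ≟ᶠ z)))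
    →-dec (g G (lookup σ x) (lookup σ y) (lookup σ z) SignP.≟ g G x y z))))

allVecs : ∀ k n → List (Vec (Fin n) k)
allVecs zero    n = [ [] ]
allVecs (suc k) n = concatMap (λ i → map (i ∷_) (allVecs k n)) (allFin n)

-- |Aut(g)|: injective maps Fin r → Fin r are exactly the permutations
autCount : ∀ {r} → OrientedTwoGraph r → ℕ
autCount {r} G = length (filter (isAut? G) (allVecs r r))

RestrIso : ∀ {m r} → OrientedTwoGraph m → Subset m → OrientedTwoGraph r → Set
RestrIso {m} {r} H A G =
  Σ (Fin r → Fin m) λ ψ →
    (∀ x y → ψ x ≡ ψ y → x ≡ y) ×
    (∀ v → (v ∈ A) ⇔ (∃ λ x → ψ x ≡ v)) ×
    (∀ x y z → Distinct3 x y z → g H (ψ x) (ψ y) (ψ z) ≡ g G x y z)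

AtMostTwoCopies : ∀ {m r} → OrientedTwoGraph m → OrientedTwoGraph r → Set
AtMostTwoCopies H G =
  ∀ A₁ A₂ A₃ → A₁ ≢ A₂ → A₂ ≢ A₃ → A₁ ≢ A₃ →
  RestrIso H A₁ G → RestrIso H A₂ G → RestrIso H A₃ G → ⊥′
  where open import Data.Empty renaming (⊥ to ⊥′)

record UniformHypergraph (r n : ℕ) : Set where
  field
    edge    : Subset n → Bool
    uniform : ∀ A → edge A ≡ true → ∣ A ∣ ≡ r

open UniformHypergraph public

allSubsets : ∀ n → List (Subset n)
allSubsets zero    = [ [] ]
allSubsets (suc n) = concatMap (λ A → (true ∷ A) ∷ (false ∷ A) ∷ []) (allSubsets n)

edgeCount : ∀ {r n} → UniformHypergraph r n → ℕ
edgeCount {r} {n} G = length (filter (λ A → edge G A BoolP.≟ true) (allSubsets n))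

-- A copy of 𝓗(r) (r+1 vertices, 3 edges) in G: an injective map
-- f : Fin (suc r) → Fin n and three distinct vertices a, b, c of
-- 𝓗(r)'s vertex set such that, for each u ∈ {a,b,c}, the image under f
-- of (vertex set minus u) is an edge of G.  (Any three r-subsets of an
-- (r+1)-set are of this form, so this is 𝓗(r) up to isomorphism.)

ImageMinus : ∀ {r n} → (Fin (suc r) → Fin n) → Fin (suc r) → Subset n → Set
ImageMinus {r} f u A = ∀ v → (v ∈ A) ⇔ (∃ λ k → k ≢ u × f k ≡ v)

ContainsH : ∀ {r n} → UniformHypergraph r n → Set
ContainsH {r} {n} G =
  Σ (Fin (suc r) → Fin n) λ f →
    (∀ x y → f x ≡ f y → x ≡ y) ×
    Σ (Fin (suc r)) λ a → Σ (Fin (suc r)) λ b → Σ (Fin (suc r)) λ c →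
      Distinct3 a b c ×
      (∀ u → (u ≡ a ⊎′ (u ≡ b ⊎′ u ≡ c)) →
         ∀ A → ImageMinus f u A → edge G A ≡ true)
  where open import Data.Sum renaming (_⊎_ to _⊎′_)

HFree : ∀ {r n} → UniformHypergraph r n → Set
HFree G = ¬ ContainsH G

-- Lower bound  p / q ≤ π(𝓗(r))  (q > 0), with π the limit of
-- ex(𝓗(r),n) / (n choose r).  Stated as: for every ε = 1/(m+1) there is
-- N such that for all n ≥ N some 𝓗(r)-free r-graph G on n vertices has
--   e(G) / (n C r) ≥ p/q − 1/(m+1),
-- written with denominators cleared:
--   (m+1)·p·(n C r) ≤ (m+1)·q·e(G) + q·(n C r).

TuranDensityAtLeast : (r p q : ℕ) → Set
TuranDensityAtLeast r p q =
  ∀ m → ∃ λ N → ∀ n → N ≤ n →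
    Σ (UniformHypergraph r n) λ G → HFree G ×
      suc m * p * (n C r) ≤ suc m * q * edgeCount G + q * (n C r)

-- Let X be a uniformly random graph on n vertices and T(X) its oriented two-graph, the coboundary
-- (x,y,z) ↦ w(x,y) w(y,z) w(x,z) of the antisymmetric signing w(a,b) = ε(a,b) (−1)^[ab ∈ X], where
-- ε(a,b) = + iff a < b.  The r-sets A on which T(X) restricts to a copy of G form an 𝓗(r)-free
-- r-graph: the three edges of a copy of 𝓗(r) would be three copies of G inside one oriented
-- two-graph on r + 1 vertices.  The restriction of X to A is a uniformly random graph on r vertices.
-- Double counting pairs (graph, isomorphism from G): each of the r! bijections is an isomorphism
-- for at least 2^(r−1) graphs (the row of one vertex is free, the rest is forced by G), and each
-- graph admits at most |Aut(g)| of them.  So A is an edge with probability at least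
-- r! / (|Aut(g)| 2^((r−1) C 2)), and some X has at least the expected number of edges.

module Submission where

open import Defs
open import Data.Nat.Base using (ℕ; zero; suc; pred; _+_; _*_; _∸_; _^_; _≤_; z≤n; s≤s; _!; NonZero)
open import Data.Nat.Properties hiding (_≟_)
import Data.Nat.Properties as ℕ
open import Data.Nat.Combinatorics using (_C_; nC1≡n; nCk+nC[k+1]≡[n+1]C[k+1])
open import Data.Nat.Tactic.RingSolver using (solve-∀)
open import Algebra.Properties.CommutativeSemigroup +-commutativeSemigroup using () renaming (interchange to +-interchange)
open import Algebra.Properties.CommutativeSemigroup *-commutativeSemigroup
  using (xy∙z≈xz∙y; xy∙z≈x∙zy; x∙yz≈y∙xz; x∙yz≈yx∙z)
open import Data.Fin.Base using (Fin; zero; suc; punchIn; punchOut)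
import Data.Fin.Properties as Fin
open import Data.Fin.Subset using (Subset; _∈_; ∣_∣; ⁅_⁆; ∁)
open import Data.Fin.Subset.Properties using (x∈⁅y⁆⇔x≡y; x∈∁p⇒x∉p; x∉p⇒x∈∁p)
open import Data.Bool.Base using (Bool; true; false)
import Data.Bool.Properties as Bool
open import Data.Unit.Base using (⊤; tt)
open import Data.Product.Base using (Σ; ∃; _×_; _,_; proj₁; proj₂)
import Data.Product.Properties as Product
open import Data.Sum.Base using (_⊎_; inj₁; inj₂)
open import Data.Vec.Base using (Vec; []; _∷_; lookup; tabulate; map; replicate)
import Data.Vec.Properties as Vec
open import Data.List.Base using (List; []; _∷_; _++_; length; filter; concatMap; concat; allFin)
import Data.List.Base as List
open import Data.Sign.Base using (Sign; opposite) renaming (_*_ to _·_)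
import Data.Sign.Properties as Sign
open import Data.Empty using (⊥-elim)
open import Function.Base using (_∘_)
open import Function.Bundles using (_⇔_; mk⇔; Equivalence)
open import Relation.Nullary using (Dec; yes; no; does; ¬_)
open import Relation.Nullary.Decidable using (_×-dec_; _→-dec_; ¬?; from-yes; dec-true)
open import Relation.Binary.Definitions using (DecidableEquality)
open import Relation.Binary.PropositionalEquality

𝟙 : ∀ {a} {A : Set a} → Dec A → ℕ
𝟙 (yes _) = 1
𝟙 (no _)  = 0

module _ {a} {A : Set a} where

  𝟙-yes : (d : Dec A) → A → 𝟙 d ≡ 1
  𝟙-yes (yes _) _ = refl
  𝟙-yes (no ¬a) a = ⊥-elim (¬a a)

  𝟙-no : (d : Dec A) → ¬ A → 𝟙 d ≡ 0
  𝟙-no (yes a) ¬a = ⊥-elim (¬a a)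
  𝟙-no (no _)  _  = refl

  𝟙-idem : (d : Dec A) → 𝟙 d * 𝟙 d ≡ 𝟙 d
  𝟙-idem (yes _) = refl
  𝟙-idem (no _)  = refl

module _ {a b} {A : Set a} {B : Set b} where

  𝟙-cong : (d : Dec A) (e : Dec B) → (A → B) → (B → A) → 𝟙 d ≡ 𝟙 e
  𝟙-cong (yes _) (yes _) _ _ = refl
  𝟙-cong (yes a) (no ¬b) f _ = ⊥-elim (¬b (f a))
  𝟙-cong (no ¬a) (yes b) _ g = ⊥-elim (¬a (g b))
  𝟙-cong (no _)  (no _)  _ _ = refl

  𝟙-× : (d : Dec A) (e : Dec B) → 𝟙 (d ×-dec e) ≡ 𝟙 d * 𝟙 e
  𝟙-× (yes _) (yes _) = refl
  𝟙-× (yes _) (no _)  = refl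
  𝟙-× (no _)  _       = refl

n*n≡n⇒n≤1 : ∀ n → n * n ≡ n → n ≤ 1
n*n≡n⇒n≤1 zero          _ = z≤n
n*n≡n⇒n≤1 (suc zero)    _ = s≤s z≤n
n*n≡n⇒n≤1 (suc (suc n)) e with +-cancelˡ-≡ (2 + n) (suc n * (2 + n)) 0 (trans e (sym (+-identityʳ _)))
... | ()

-- Finite sums

record IsLinear {X : Set} (∑ : (X → ℕ) → ℕ) : Set where
  field
    ∑-cong : ∀ {F G : X → ℕ} → (∀ x → F x ≡ G x) → ∑ F ≡ ∑ G
    ∑-+    : ∀ (F G : X → ℕ) → ∑ (λ x → F x + G x) ≡ ∑ F + ∑ G
    ∑-0    : ∑ (λ _ → 0) ≡ 0

record Summable (X : Set) : Set₁ where
  field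
    ∑      : (X → ℕ) → ℕ
    linear : IsLinear ∑
    fubini : ∀ {Y : Set} (T : (Y → ℕ) → ℕ) → IsLinear T → (F : X → Y → ℕ) →
             ∑ (λ x → T (F x)) ≡ T (λ y → ∑ (λ x → F x y))
    _≟_    : DecidableEquality X
    ∑-δ    : ∀ a → ∑ (λ x → 𝟙 (a ≟ x)) ≡ 1
    any?   : {P : X → Set} → (∀ x → Dec (P x)) → Dec (∃ P)
    argmax : X → (F : X → ℕ) → ∃ λ x → ∀ y → F y ≤ F x

module Sum {X : Set} (S : Summable X) where
  open Summable S public
  open IsLinear linear public

  ∑-*ˡ : ∀ c (F : X → ℕ) → ∑ (λ x → c * F x) ≡ c * ∑ F
  ∑-*ˡ zero    F = ∑-0
  ∑-*ˡ (suc c) F = trans (∑-+ F (λ x → c * F x)) (cong (∑ F +_) (∑-*ˡ c F))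

  ∑-*ʳ : ∀ c (F : X → ℕ) → ∑ (λ x → F x * c) ≡ ∑ F * c
  ∑-*ʳ c F = trans (∑-cong (λ x → *-comm (F x) c)) (trans (∑-*ˡ c F) (*-comm c (∑ F)))

  ∑-const : ∀ c → ∑ (λ _ → c) ≡ c * ∑ (λ _ → 1)
  ∑-const c = trans (∑-cong (λ _ → sym (*-identityʳ c))) (∑-*ˡ c (λ _ → 1))

  ∑-zero : ∀ {F : X → ℕ} → (∀ x → F x ≡ 0) → ∑ F ≡ 0
  ∑-zero F≡0 = trans (∑-cong F≡0) ∑-0

  ∑-mono-≤ : ∀ {F G : X → ℕ} → (∀ x → F x ≤ G x) → ∑ F ≤ ∑ G
  ∑-mono-≤ {F} {G} F≤G = begin
    ∑ F                          ≤⟨ m≤m+n (∑ F) _ ⟩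
    ∑ F + ∑ (λ x → G x ∸ F x)    ≡⟨ ∑-+ F _ ⟨
    ∑ (λ x → F x + (G x ∸ F x))  ≡⟨ ∑-cong (λ x → m+[n∸m]≡n (F≤G x)) ⟩
    ∑ G                          ∎
    where open ≤-Reasoning

  ∑-δ* : ∀ a (F : X → ℕ) → ∑ (λ x → 𝟙 (a ≟ x) * F x) ≡ F a
  ∑-δ* a F = begin
    ∑ (λ x → 𝟙 (a ≟ x) * F x)  ≡⟨ ∑-cong δF≡δFa ⟩
    ∑ (λ x → 𝟙 (a ≟ x) * F a)  ≡⟨ ∑-*ʳ (F a) _ ⟩
    ∑ (λ x → 𝟙 (a ≟ x)) * F a  ≡⟨ cong (_* F a) (∑-δ a) ⟩
    1 * F a                    ≡⟨ *-identityˡ (F a) ⟩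
    F a                        ∎
    where
    open ≡-Reasoning
    δF≡δFa : ∀ x → 𝟙 (a ≟ x) * F x ≡ 𝟙 (a ≟ x) * F a
    δF≡δFa x with a ≟ x
    ... | yes refl = refl
    ... | no _     = refl

  F≤∑F : ∀ (F : X → ℕ) a → F a ≤ ∑ F
  F≤∑F F a = begin
    F a                        ≡⟨ ∑-δ* a F ⟨
    ∑ (λ x → 𝟙 (a ≟ x) * F x)  ≤⟨ ∑-mono-≤ δF≤F ⟩
    ∑ F                        ∎
    where
    open ≤-Reasoning
    δF≤F : ∀ x → 𝟙 (a ≟ x) * F x ≤ F x
    δF≤F x with a ≟ x
    ... | yes _ = ≤-reflexive (+-identityʳ (F x))
    ... | no _  = z≤n

  -- With s = ∑ 𝟙R, uniqueness collapses the double sum s * s onto its diagonal, so s * s ≡ s.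
  ∑-𝟙-unique≤1 : ∀ {R : X → Set} (R? : ∀ x → Dec (R x)) →
                 (∀ x y → R x → R y → x ≡ y) → ∑ (λ x → 𝟙 (R? x)) ≤ 1
  ∑-𝟙-unique≤1 {R} R? unique = n*n≡n⇒n≤1 s s*s≡s
    where
    s : ℕ
    s = ∑ (λ x → 𝟙 (R? x))
    off-diagonal : ∀ x y → 𝟙 (R? x) * 𝟙 (R? y) ≡ 𝟙 (x ≟ y) * (𝟙 (R? x) * 𝟙 (R? y))
    off-diagonal x y with R? x | R? y
    ... | no _  | _     = sym (*-zeroʳ (𝟙 (x ≟ y)))
    ... | yes _ | no _  = sym (*-zeroʳ (𝟙 (x ≟ y)))
    ... | yes rx | yes ry with x ≟ y
    ...   | yes _  = refl
    ...   | no x≢y = ⊥-elim (x≢y (unique x y rx ry))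
    s*s≡s : s * s ≡ s
    s*s≡s = begin
      s * s                                                      ≡⟨ ∑-*ʳ s _ ⟨
      ∑ (λ x → 𝟙 (R? x) * s)                                     ≡⟨ ∑-cong (λ x → ∑-*ˡ (𝟙 (R? x)) _) ⟨
      ∑ (λ x → ∑ (λ y → 𝟙 (R? x) * 𝟙 (R? y)))                    ≡⟨ ∑-cong (λ x → ∑-cong (off-diagonal x)) ⟩
      ∑ (λ x → ∑ (λ y → 𝟙 (x ≟ y) * (𝟙 (R? x) * 𝟙 (R? y))))      ≡⟨ ∑-cong (λ x → ∑-δ* x _) ⟩
      ∑ (λ x → 𝟙 (R? x) * 𝟙 (R? x))                              ≡⟨ ∑-cong (λ x → 𝟙-idem (R? x)) ⟩
      s                                                          ∎
      where open ≡-Reasoning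

module _ {X Y : Set} (SX : Summable X) (SY : Summable Y) where
  private
    module X = Sum SX
    module Y = Sum SY

  count-≤-injection : {P : X → Set} {Q : Y → Set} (P? : ∀ x → Dec (P x)) (Q? : ∀ y → Dec (Q y))
    (ψ : X → Y) → (∀ x → P x → Q (ψ x)) → (∀ x x′ → P x → P x′ → ψ x ≡ ψ x′ → x ≡ x′) →
    X.∑ (λ x → 𝟙 (P? x)) ≤ Y.∑ (λ y → 𝟙 (Q? y))
  count-≤-injection {P} {Q} P? Q? ψ P⇒Q ψ-injective = begin
    X.∑ (λ x → 𝟙 (P? x))                                          ≡⟨ X.∑-cong graph-sum ⟨
    X.∑ (λ x → Y.∑ (λ y → 𝟙 (Y._≟_ (ψ x) y) * (𝟙 (P? x) * 𝟙 (Q? y)))) ≡⟨ X.fubini Y.∑ Y.linear _ ⟩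
    Y.∑ (λ y → X.∑ (λ x → 𝟙 (Y._≟_ (ψ x) y) * (𝟙 (P? x) * 𝟙 (Q? y)))) ≡⟨ Y.∑-cong (λ y → X.∑-cong (λ x → regroup x y)) ⟩
    Y.∑ (λ y → X.∑ (λ x → 𝟙 (fibre? y x) * 𝟙 (Q? y)))                ≡⟨ Y.∑-cong (λ y → X.∑-*ʳ (𝟙 (Q? y)) _) ⟩
    Y.∑ (λ y → X.∑ (λ x → 𝟙 (fibre? y x)) * 𝟙 (Q? y))                ≤⟨ Y.∑-mono-≤ (λ y → *-monoˡ-≤ (𝟙 (Q? y)) (X.∑-𝟙-unique≤1 (fibre? y) (fibre-unique y))) ⟩
    Y.∑ (λ y → 1 * 𝟙 (Q? y))                                       ≡⟨ Y.∑-cong (λ y → *-identityˡ _) ⟩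
    Y.∑ (λ y → 𝟙 (Q? y))                                           ∎
    where
    open ≤-Reasoning
    fibre? : ∀ y x → Dec (ψ x ≡ y × P x)
    fibre? y x = Y._≟_ (ψ x) y ×-dec P? x
    fibre-unique : ∀ y x x′ → ψ x ≡ y × P x → ψ x′ ≡ y × P x′ → x ≡ x′
    fibre-unique y x x′ (ψx≡y , px) (ψx′≡y , px′) = ψ-injective x x′ px px′ (trans ψx≡y (sym ψx′≡y))
    graph-sum : ∀ x → Y.∑ (λ y → 𝟙 (Y._≟_ (ψ x) y) * (𝟙 (P? x) * 𝟙 (Q? y))) ≡ 𝟙 (P? x)
    graph-sum x with P? x
    ... | no _   = Y.∑-zero (λ y → *-zeroʳ (𝟙 (Y._≟_ (ψ x) y)))
    ... | yes px = trans (Y.∑-δ* (ψ x) (λ y → 1 * 𝟙 (Q? y))) (trans (*-identityˡ _) (𝟙-yes (Q? (ψ x)) (P⇒Q x px)))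
    regroup : ∀ x y → 𝟙 (Y._≟_ (ψ x) y) * (𝟙 (P? x) * 𝟙 (Q? y)) ≡ 𝟙 (fibre? y x) * 𝟙 (Q? y)
    regroup x y = trans (sym (*-assoc (𝟙 (Y._≟_ (ψ x) y)) _ _)) (cong (_* 𝟙 (Q? y)) (sym (𝟙-× (Y._≟_ (ψ x) y) (P? x))))

∑-Fin : ∀ n → (Fin n → ℕ) → ℕ
∑-Fin zero    F = 0
∑-Fin (suc n) F = F zero + ∑-Fin n (λ x → F (suc x))

∑-Fin-linear : ∀ n → IsLinear (∑-Fin n)
∑-Fin-linear n = record { ∑-cong = ∑-cong n ; ∑-+ = ∑-+ n ; ∑-0 = ∑-0 n }
  where
  ∑-cong : ∀ n {F G : Fin n → ℕ} → (∀ x → F x ≡ G x) → ∑-Fin n F ≡ ∑-Fin n G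
  ∑-cong zero    _   = refl
  ∑-cong (suc n) F≡G = cong₂ _+_ (F≡G zero) (∑-cong n (λ x → F≡G (suc x)))
  ∑-+ : ∀ n (F G : Fin n → ℕ) → ∑-Fin n (λ x → F x + G x) ≡ ∑-Fin n F + ∑-Fin n G
  ∑-+ zero    F G = refl
  ∑-+ (suc n) F G = trans (cong (F zero + G zero +_) (∑-+ n (λ x → F (suc x)) (λ x → G (suc x)))) (+-interchange (F zero) (G zero) _ _)
  ∑-0 : ∀ n → ∑-Fin n (λ _ → 0) ≡ 0
  ∑-0 zero    = refl
  ∑-0 (suc n) = ∑-0 n

∑-Fin-fubini : ∀ n {Y : Set} (T : (Y → ℕ) → ℕ) → IsLinear T → (F : Fin n → Y → ℕ) →
               ∑-Fin n (λ x → T (F x)) ≡ T (λ y → ∑-Fin n (λ x → F x y))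
∑-Fin-fubini zero    T T-linear F = sym (IsLinear.∑-0 T-linear)
∑-Fin-fubini (suc n) T T-linear F =
  trans (cong (T (F zero) +_) (∑-Fin-fubini n T T-linear (λ x → F (suc x))))
        (sym (IsLinear.∑-+ T-linear (F zero) _))

∑-Fin-δ : ∀ n (a : Fin n) → ∑-Fin n (λ x → 𝟙 (a Fin.≟ x)) ≡ 1
∑-Fin-δ (suc n) zero    = cong suc (trans (IsLinear.∑-cong (∑-Fin-linear n) (λ x → 𝟙-no (zero Fin.≟ suc x) λ ()))
                                          (IsLinear.∑-0 (∑-Fin-linear n)))
∑-Fin-δ (suc n) (suc a) = trans (IsLinear.∑-cong (∑-Fin-linear n) (λ x → 𝟙-cong (suc a Fin.≟ suc x) (a Fin.≟ x) Fin.suc-injective (cong suc)))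
                                (∑-Fin-δ n a)

Fin-argmax : ∀ n → Fin n → (F : Fin n → ℕ) → ∃ λ x → ∀ y → F y ≤ F x
Fin-argmax (suc zero)    zero F = zero , λ { zero → ≤-refl }
Fin-argmax (suc (suc n)) _    F with Fin-argmax (suc n) zero (λ x → F (suc x))
... | m , F≤Fm with F zero ≤? F (suc m)
...   | yes F0≤Fm = suc m , λ { zero → F0≤Fm ; (suc y) → F≤Fm y }
...   | no  F0≰Fm = zero  , λ { zero → ≤-refl ; (suc y) → ≤-trans (F≤Fm y) (<⇒≤ (≰⇒> F0≰Fm)) }

Fin-summable : ∀ n → Summable (Fin n)
Fin-summable n = record
  { ∑ = ∑-Fin n ; linear = ∑-Fin-linear n ; fubini = ∑-Fin-fubini n ; _≟_ = Fin._≟_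
  ; ∑-δ = ∑-Fin-δ n ; any? = Fin.any? ; argmax = Fin-argmax n }

×-summable : ∀ {A B : Set} → Summable A → Summable B → Summable (A × B)
×-summable {A} {B} SA SB = record
  { ∑      = ∑×
  ; linear = record
    { ∑-cong = λ F≡G → A.∑-cong (λ a → B.∑-cong (λ b → F≡G (a , b)))
    ; ∑-+    = λ F G → trans (A.∑-cong (λ a → B.∑-+ (λ b → F (a , b)) (λ b → G (a , b)))) (A.∑-+ _ _)
    ; ∑-0    = trans (A.∑-cong (λ _ → B.∑-0)) A.∑-0 }
  ; fubini = λ T T-linear F → trans (A.∑-cong (λ a → B.fubini T T-linear (λ b → F (a , b))))
                                    (A.fubini T T-linear (λ a y → B.∑ (λ b → F (a , b) y)))
  ; _≟_    = _≟×_
  ; ∑-δ    = ∑×-δ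
  ; any?   = any×?
  ; argmax = argmax× }
  where
  module A = Sum SA
  module B = Sum SB
  ∑× : (A × B → ℕ) → ℕ
  ∑× F = A.∑ (λ a → B.∑ (λ b → F (a , b)))
  _≟×_ : DecidableEquality (A × B)
  _≟×_ = Product.≡-dec A._≟_ B._≟_
  𝟙-≟× : ∀ a b a′ b′ → 𝟙 ((a , b) ≟× (a′ , b′)) ≡ 𝟙 (a A.≟ a′) * 𝟙 (b B.≟ b′)
  𝟙-≟× a b a′ b′ = trans (𝟙-cong ((a , b) ≟× (a′ , b′)) (a A.≟ a′ ×-dec b B.≟ b′)
                                  (λ e → cong proj₁ e , cong proj₂ e) (λ { (refl , refl) → refl }))
                          (𝟙-× (a A.≟ a′) (b B.≟ b′))
  ∑×-δ : ∀ (x : A × B) → ∑× (λ y → 𝟙 (x ≟× y)) ≡ 1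
  ∑×-δ (a , b) = begin
    A.∑ (λ a′ → B.∑ (λ b′ → 𝟙 ((a , b) ≟× (a′ , b′))))        ≡⟨ A.∑-cong (λ a′ → B.∑-cong (𝟙-≟× a b a′)) ⟩
    A.∑ (λ a′ → B.∑ (λ b′ → 𝟙 (a A.≟ a′) * 𝟙 (b B.≟ b′)))     ≡⟨ A.∑-cong (λ a′ → B.∑-*ˡ (𝟙 (a A.≟ a′)) _) ⟩
    A.∑ (λ a′ → 𝟙 (a A.≟ a′) * B.∑ (λ b′ → 𝟙 (b B.≟ b′)))     ≡⟨ A.∑-cong (λ a′ → cong (𝟙 (a A.≟ a′) *_) (B.∑-δ b)) ⟩
    A.∑ (λ a′ → 𝟙 (a A.≟ a′) * 1)                              ≡⟨ A.∑-δ* a (λ _ → 1) ⟩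
    1                                                          ∎
    where open ≡-Reasoning
  any×? : {P : A × B → Set} → (∀ x → Dec (P x)) → Dec (∃ P)
  any×? P? with A.any? (λ a → B.any? (λ b → P? (a , b)))
  ... | yes (a , b , p) = yes ((a , b) , p)
  ... | no ∄ab          = no λ { ((a , b) , p) → ∄ab (a , b , p) }
  argmax× : A × B → (F : A × B → ℕ) → ∃ λ x → ∀ y → F y ≤ F x
  argmax× (a₀ , b₀) F = (a* , best a*) , λ (a , b) → ≤-trans (proj₂ (B.argmax b₀ (λ b → F (a , b))) b) (proj₂ (A.argmax a₀ F-best) a)
    where
    best : A → B
    best a = proj₁ (B.argmax b₀ (λ b → F (a , b)))
    F-best : A → ℕ
    F-best a = F (a , best a)
    a* : A
    a* = proj₁ (A.argmax a₀ F-best)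

↔-summable : ∀ {A B : Set} → Summable A → (to : A → B) (from : B → A) →
             (∀ a → from (to a) ≡ a) → (∀ b → to (from b) ≡ b) → Summable B
↔-summable {A} {B} SA to from from∘to to∘from = record
  { ∑      = λ F → A.∑ (λ a → F (to a))
  ; linear = record { ∑-cong = λ F≡G → A.∑-cong (λ a → F≡G (to a)) ; ∑-+ = λ _ _ → A.∑-+ _ _ ; ∑-0 = A.∑-0 }
  ; fubini = λ T T-linear F → A.fubini T T-linear (λ a → F (to a))
  ; _≟_    = _≟B_
  ; ∑-δ    = λ b → trans (A.∑-cong (λ a → 𝟙-cong (b ≟B to a) (from b A.≟ a)
                                        (λ b≡ → trans (cong from b≡) (from∘to a))
                                        (λ ≡a → trans (sym (to∘from b)) (cong to ≡a))))
                          (A.∑-δ (from b))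
  ; any?   = any?B
  ; argmax = λ b₀ F → let (a , F≤) = A.argmax (from b₀) (λ a → F (to a))
                      in to a , λ b → subst (λ b′ → F b′ ≤ F (to a)) (to∘from b) (F≤ (from b)) }
  where
  module A = Sum SA
  _≟B_ : DecidableEquality B
  b ≟B b′ with A._≟_ (from b) (from b′)
  ... | yes e  = yes (trans (sym (to∘from b)) (trans (cong to e) (to∘from b′)))
  ... | no  ne = no (λ e → ne (cong from e))
  any?B : {P : B → Set} → (∀ x → Dec (P x)) → Dec (∃ P)
  any?B {P} P? with A.any? (λ a → P? (to a))
  ... | yes (a , p) = yes (to a , p)
  ... | no ∄a       = no λ (b , p) → ∄a (from b , subst P (sym (to∘from b)) p)

⊤-summable : Summable ⊤
⊤-summable = ↔-summable (Fin-summable 1) (λ _ → tt) (λ _ → zero) (λ { zero → refl }) (λ { tt → refl })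

Bool-summable : Summable Bool
Bool-summable = ↔-summable (Fin-summable 2) (λ { zero → true ; (suc _) → false }) (λ { true → zero ; false → suc zero })
                           (λ { zero → refl ; (suc zero) → refl }) (λ { true → refl ; false → refl })

Vec-summable : ∀ {A : Set} → Summable A → ∀ k → Summable (Vec A k)
Vec-summable SA zero    = ↔-summable ⊤-summable (λ _ → []) (λ _ → tt) (λ { tt → refl }) (λ { [] → refl })
Vec-summable SA (suc k) = ↔-summable (×-summable SA (Vec-summable SA k)) (λ (a , v) → a ∷ v) (λ { (a ∷ v) → a , v })
                                     (λ _ → refl) (λ { (a ∷ v) → refl })

-- A graph on Fin (suc n): the adjacency row of vertex 0 followed by a graph on the remaining n vertices.
Graph : ℕ → Set
Graph zero    = ⊤
Graph (suc n) = Vec Bool n × Graph n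

adjacent : ∀ {n} → Graph n → Fin n → Fin n → Bool
adjacent {suc n} (row , X) zero    zero    = false
adjacent {suc n} (row , X) zero    (suc j) = lookup row j
adjacent {suc n} (row , X) (suc i) zero    = lookup row i
adjacent {suc n} (row , X) (suc i) (suc j) = adjacent X i j

adjacent-sym : ∀ {n} (X : Graph n) a b → adjacent X b a ≡ adjacent X a b
adjacent-sym {suc n} X zero    zero    = refl
adjacent-sym {suc n} X zero    (suc j) = refl
adjacent-sym {suc n} X (suc i) zero    = refl
adjacent-sym {suc n} (_ , X) (suc i) (suc j) = adjacent-sym X i j

emptyGraph : ∀ n → Graph n
emptyGraph zero    = tt
emptyGraph (suc n) = replicate n false , emptyGraph n

Row-summable : ∀ n → Summable (Vec Bool n)
Row-summable = Vec-summable Bool-summable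

Graph-summable : ∀ n → Summable (Graph n)
Graph-summable zero    = ⊤-summable
Graph-summable (suc n) = ×-summable (Row-summable n) (Graph-summable n)

module Row n = Sum (Row-summable n)
module Gr n = Sum (Graph-summable n)

rowCount : ℕ → ℕ
rowCount n = Row.∑ n (λ _ → 1)

graphCount : ℕ → ℕ
graphCount n = Gr.∑ n (λ _ → 1)

rowCount≡2^n : ∀ n → rowCount n ≡ 2 ^ n
rowCount≡2^n zero    = refl
rowCount≡2^n (suc n) = trans (cong₂ _+_ (rowCount≡2^n n) (cong (_+ 0) (rowCount≡2^n n))) (double (2 ^ n))
  where
  double : ∀ x → x + (x + 0) ≡ 2 * x
  double = solve-∀

graphCount-suc : ∀ n → graphCount (suc n) ≡ graphCount n * rowCount n
graphCount-suc n = Row.∑-const n (graphCount n)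

graphCount≡2^[nC2] : ∀ n → graphCount n ≡ 2 ^ (n C 2)
graphCount≡2^[nC2] zero    = refl
graphCount≡2^[nC2] (suc n) = begin
  graphCount (suc n)       ≡⟨ graphCount-suc n ⟩
  graphCount n * rowCount n ≡⟨ cong₂ _*_ (graphCount≡2^[nC2] n) (rowCount≡2^n n) ⟩
  2 ^ (n C 2) * 2 ^ n       ≡⟨ ^-distribˡ-+-* 2 (n C 2) n ⟨
  2 ^ (n C 2 + n)           ≡⟨ cong (2 ^_) [1+n]C2 ⟩
  2 ^ (suc n C 2)           ∎
  where
  open ≡-Reasoning
  [1+n]C2 : n C 2 + n ≡ suc n C 2
  [1+n]C2 = trans (+-comm (n C 2) n) (trans (cong (_+ n C 2) (sym (nC1≡n n))) (nCk+nC[k+1]≡[n+1]C[k+1] n 1))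

-- Induced subgraphs

size : ∀ {n} → Vec Bool n → ℕ
size []          = 0
size (true ∷ A)  = suc (size A)
size (false ∷ A) = size A

size≡∣∣ : ∀ {n} (A : Subset n) → size A ≡ ∣ A ∣
size≡∣∣ []          = refl
size≡∣∣ (true ∷ A)  = cong suc (size≡∣∣ A)
size≡∣∣ (false ∷ A) = size≡∣∣ A

select : ∀ {n} {B : Set} → Vec B n → (A : Vec Bool n) → Vec B (size A)
select []      []          = []
select (x ∷ v) (true ∷ A)  = x ∷ select v A
select (x ∷ v) (false ∷ A) = select v A

restrict : ∀ {n} → Graph n → (A : Vec Bool n) → Graph (size A)
restrict {zero}  tt        []          = tt
restrict {suc n} (row , X) (true ∷ A)  = select row A , restrict X A
restrict {suc n} (row , X) (false ∷ A) = restrict X A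

embed : ∀ {n} (A : Vec Bool n) → Fin (size A) → Fin n
embed (true ∷ A)  zero    = zero
embed (true ∷ A)  (suc j) = suc (embed A j)
embed (false ∷ A) j       = suc (embed A j)

lookup-select : ∀ {n} {B : Set} (v : Vec B n) (A : Vec Bool n) j → lookup (select v A) j ≡ lookup v (embed A j)
lookup-select (x ∷ v) (true ∷ A)  zero    = refl
lookup-select (x ∷ v) (true ∷ A)  (suc j) = lookup-select v A j
lookup-select (x ∷ v) (false ∷ A) j       = lookup-select v A j

adjacent-restrict : ∀ {n} (X : Graph n) (A : Vec Bool n) a b →
                    adjacent (restrict X A) a b ≡ adjacent X (embed A a) (embed A b)
adjacent-restrict {suc n} (row , X) (true ∷ A)  zero    zero    = refl
adjacent-restrict {suc n} (row , X) (true ∷ A)  zero    (suc b) = lookup-select row A b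
adjacent-restrict {suc n} (row , X) (true ∷ A)  (suc a) zero    = lookup-select row A a
adjacent-restrict {suc n} (row , X) (true ∷ A)  (suc a) (suc b) = adjacent-restrict X A a b
adjacent-restrict {suc n} (row , X) (false ∷ A) a       b       = adjacent-restrict X A a b

embed-injective : ∀ {n} (A : Vec Bool n) i j → embed A i ≡ embed A j → i ≡ j
embed-injective (true ∷ A)  zero    zero    _ = refl
embed-injective (true ∷ A)  (suc i) (suc j) e = cong suc (embed-injective A i j (Fin.suc-injective e))
embed-injective (false ∷ A) i       j       e = embed-injective A i j (Fin.suc-injective e)

embed-∈ : ∀ {n} (A : Vec Bool n) j → lookup A (embed A j) ≡ true
embed-∈ (true ∷ A)  zero    = refl
embed-∈ (true ∷ A)  (suc j) = embed-∈ A j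
embed-∈ (false ∷ A) j       = embed-∈ A j

embed-onto : ∀ {n} (A : Vec Bool n) v → lookup A v ≡ true → ∃ λ j → embed A j ≡ v
embed-onto (true ∷ A)  zero    _ = zero , refl
embed-onto (true ∷ A)  (suc v) e with j , refl ← embed-onto A v e = suc j , refl
embed-onto (false ∷ A) (suc v) e with j , refl ← embed-onto A v e = j , refl

-- Restricting a uniformly random graph on Fin n to A gives a uniformly random graph on A.
∑-select : ∀ n (A : Vec Bool n) (Φ : Vec Bool (size A) → ℕ) →
           Row.∑ n (λ v → Φ (select v A)) * rowCount (size A) ≡ Row.∑ (size A) Φ * rowCount n
∑-select zero    []          Φ = refl
∑-select (suc n) (true ∷ A)  Φ =
  sum-of-two (x true) (x false) (y true) (y false) (rowCount (size A)) (rowCount n)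
             (∑-select n A (λ u → Φ (true ∷ u))) (∑-select n A (λ u → Φ (false ∷ u)))
  where
  -- A sum over Vec Bool (suc n) unfolds to the sum over the head true plus (the sum over false plus 0).
  x y : Bool → ℕ
  x b = Row.∑ n (λ v → Φ (b ∷ select v A))
  y b = Row.∑ (size A) (λ u → Φ (b ∷ u))
  sum-of-two : ∀ x₁ x₂ y₁ y₂ c d → x₁ * c ≡ y₁ * d → x₂ * c ≡ y₂ * d →
               (x₁ + (x₂ + 0)) * (c + (c + 0)) ≡ (y₁ + (y₂ + 0)) * (d + (d + 0))
  sum-of-two x₁ x₂ y₁ y₂ c d e₁ e₂ = begin
    (x₁ + (x₂ + 0)) * (c + (c + 0)) ≡⟨ expand x₁ x₂ c ⟩
    2 * (x₁ * c + x₂ * c)           ≡⟨ cong (λ t → 2 * t) (cong₂ _+_ e₁ e₂) ⟩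
    2 * (y₁ * d + y₂ * d)           ≡⟨ expand y₁ y₂ d ⟨
    (y₁ + (y₂ + 0)) * (d + (d + 0)) ∎
    where
    open ≡-Reasoning
    expand : ∀ x₁ x₂ c → (x₁ + (x₂ + 0)) * (c + (c + 0)) ≡ 2 * (x₁ * c + x₂ * c)
    expand = solve-∀
∑-select (suc n) (false ∷ A) Φ =
  doubled (Row.∑ n (λ v → Φ (select v A))) (Row.∑ (size A) Φ) (rowCount (size A)) (rowCount n) (∑-select n A Φ)
  where
  doubled : ∀ x y c d → x * c ≡ y * d → (x + (x + 0)) * c ≡ y * (d + (d + 0))
  doubled x y c d e = begin
    (x + (x + 0)) * c ≡⟨ expand x c ⟩
    2 * (x * c)       ≡⟨ cong (2 *_) e ⟩
    2 * (y * d)       ≡⟨ expand′ y d ⟩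
    y * (d + (d + 0)) ∎
    where
    open ≡-Reasoning
    expand : ∀ x c → (x + (x + 0)) * c ≡ 2 * (x * c)
    expand = solve-∀
    expand′ : ∀ y d → 2 * (y * d) ≡ y * (d + (d + 0))
    expand′ = solve-∀

∑-restrict : ∀ n (A : Vec Bool n) (F : Graph (size A) → ℕ) →
             Gr.∑ n (λ X → F (restrict X A)) * graphCount (size A) ≡ Gr.∑ (size A) F * graphCount n
∑-restrict zero    []          F = refl
∑-restrict (suc n) (false ∷ A) F = begin
  Row.∑ n (λ _ → Z) * graphCount s          ≡⟨ cong (_* graphCount s) (Row.∑-const n Z) ⟩
  Z * rowCount n * graphCount s             ≡⟨ xy∙z≈xz∙y Z (rowCount n) (graphCount s) ⟩
  Z * graphCount s * rowCount n             ≡⟨ cong (_* rowCount n) (∑-restrict n A F) ⟩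
  Gr.∑ s F * graphCount n * rowCount n      ≡⟨ *-assoc (Gr.∑ s F) (graphCount n) (rowCount n) ⟩
  Gr.∑ s F * (graphCount n * rowCount n)    ≡⟨ cong (Gr.∑ s F *_) (graphCount-suc n) ⟨
  Gr.∑ s F * graphCount (suc n)             ∎
  where
  open ≡-Reasoning
  s : ℕ
  s = size A
  Z : ℕ
  Z = Gr.∑ n (λ X → F (restrict X A))
∑-restrict (suc n) (true ∷ A) F = begin
  Row.∑ n (λ row → Z row) * graphCount (suc s)                        ≡⟨ cong (Row.∑ n Z *_) (graphCount-suc s) ⟩
  Row.∑ n (λ row → Z row) * (graphCount s * rowCount s)               ≡⟨ *-assoc (Row.∑ n Z) (graphCount s) (rowCount s) ⟨
  Row.∑ n (λ row → Z row) * graphCount s * rowCount s                 ≡⟨ cong (_* rowCount s) (Row.∑-*ʳ n (graphCount s) Z) ⟨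
  Row.∑ n (λ row → Z row * graphCount s) * rowCount s                 ≡⟨ cong (_* rowCount s) (Row.∑-cong n (λ row → ∑-restrict n A (λ H → F (select row A , H)))) ⟩
  Row.∑ n (λ row → Φ (select row A) * graphCount n) * rowCount s      ≡⟨ cong (_* rowCount s) (Row.∑-*ʳ n (graphCount n) _) ⟩
  Row.∑ n (λ row → Φ (select row A)) * graphCount n * rowCount s      ≡⟨ xy∙z≈xz∙y (Row.∑ n (λ row → Φ (select row A))) (graphCount n) (rowCount s) ⟩
  Row.∑ n (λ row → Φ (select row A)) * rowCount s * graphCount n      ≡⟨ cong (_* graphCount n) (∑-select n A Φ) ⟩
  Row.∑ s Φ * rowCount n * graphCount n                               ≡⟨ xy∙z≈x∙zy (Row.∑ s Φ) (rowCount n) (graphCount n) ⟩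
  Row.∑ s Φ * (graphCount n * rowCount n)                             ≡⟨ cong (Row.∑ s Φ *_) (graphCount-suc n) ⟨
  Row.∑ s Φ * graphCount (suc n)                                      ∎
  where
  open ≡-Reasoning
  s : ℕ
  s = size A
  Z : Vec Bool n → ℕ
  Z row = Gr.∑ n (λ X → F (select row A , restrict X A))
  Φ : Vec Bool s → ℕ
  Φ u = Gr.∑ s (λ H → F (u , H))

-- Oriented two-graphs

∀-sign? : {P : Sign → Set} → (∀ s → Dec (P s)) → Dec (∀ s → P s)
∀-sign? P? with P? Sign.+ | P? Sign.-
... | yes p | yes m = yes λ { Sign.+ → p ; Sign.- → m }
... | no ¬p | _     = no λ f → ¬p (f Sign.+)
... | _     | no ¬m = no λ f → ¬m (f Sign.-)

private
  sign-swap₁₂ : ∀ a b c → (opposite a · c) · b ≡ opposite ((a · b) · c)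
  sign-swap₁₂ = from-yes (∀-sign? λ a → ∀-sign? λ b → ∀-sign? λ c → (opposite a · c) · b Sign.≟ opposite ((a · b) · c))

  sign-swap₂₃ : ∀ a b c → (c · opposite b) · a ≡ opposite ((a · b) · c)
  sign-swap₂₃ = from-yes (∀-sign? λ a → ∀-sign? λ b → ∀-sign? λ c → (c · opposite b) · a Sign.≟ opposite ((a · b) · c))

  sign-swap₁₃ : ∀ a b c → (opposite b · opposite a) · opposite c ≡ opposite ((a · b) · c)
  sign-swap₁₃ = from-yes (∀-sign? λ a → ∀-sign? λ b → ∀-sign? λ c → (opposite b · opposite a) · opposite c Sign.≟ opposite ((a · b) · c))

  sign-cocycle : ∀ a b c d e f →
    (((a · b) · c) · ((opposite a · d) · e)) · ((opposite b · e) · f) · ((c · f) · d) ≡ Sign.+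
  sign-cocycle = from-yes (∀-sign? λ a → ∀-sign? λ b → ∀-sign? λ c → ∀-sign? λ d → ∀-sign? λ e → ∀-sign? λ f →
    (((a · b) · c) · ((opposite a · d) · e)) · ((opposite b · e) · f) · ((c · f) · d) Sign.≟ Sign.+)

  sign-solve-cocycle : ∀ a b c d → ((a · b) · c) · d ≡ Sign.+ → a ≡ (b · c) · d
  sign-solve-cocycle = from-yes (∀-sign? λ a → ∀-sign? λ b → ∀-sign? λ c → ∀-sign? λ d →
    (((a · b) · c) · d Sign.≟ Sign.+) →-dec (a Sign.≟ (b · c) · d))

  opposite-· : ∀ a b → opposite a · b ≡ opposite (a · b)
  opposite-· = from-yes (∀-sign? λ a → ∀-sign? λ b → opposite a · b Sign.≟ opposite (a · b))

  opposite-·-opposite : ∀ a b → opposite a · opposite b ≡ a · b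
  opposite-·-opposite = from-yes (∀-sign? λ a → ∀-sign? λ b → opposite a · opposite b Sign.≟ a · b)

  opposite-·-swap : ∀ a b c → opposite a · (c · b) ≡ opposite (a · (b · c))
  opposite-·-swap = from-yes (∀-sign? λ a → ∀-sign? λ b → ∀-sign? λ c → opposite a · (c · b) Sign.≟ opposite (a · (b · c)))

  ·-self-cancel : ∀ a b → a · (a · b) ≡ b
  ·-self-cancel = from-yes (∀-sign? λ a → ∀-sign? λ b → a · (a · b) Sign.≟ b)

  ·-cancel-twice : ∀ p x y → ((p · (x · y)) · opposite y) · opposite x ≡ p
  ·-cancel-twice = from-yes (∀-sign? λ p → ∀-sign? λ x → ∀-sign? λ y → ((p · (x · y)) · opposite y) · opposite x Sign.≟ p)

Injective : ∀ {m n} → (Fin m → Fin n) → Set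
Injective f = ∀ i j → f i ≡ f j → i ≡ j

Distinct3-map : ∀ {m k} (f : Fin m → Fin k) → Injective f →
                ∀ {x y z} → Distinct3 x y z → Distinct3 (f x) (f y) (f z)
Distinct3-map f f-inj (x≢y , y≢z , x≢z) = (λ e → x≢y (f-inj _ _ e)) , (λ e → y≢z (f-inj _ _ e)) , (λ e → x≢z (f-inj _ _ e))

relabel : ∀ {m n} (f : Fin m → Fin n) → Injective f → OrientedTwoGraph n → OrientedTwoGraph m
relabel f f-inj G = record
  { g       = λ x y z → g G (f x) (f y) (f z)
  ; swap₁₂  = λ x y z d → swap₁₂ G _ _ _ (Distinct3-map f f-inj d)
  ; swap₂₃  = λ x y z d → swap₂₃ G _ _ _ (Distinct3-map f f-inj d)
  ; swap₁₃  = λ x y z d → swap₁₃ G _ _ _ (Distinct3-map f f-inj d)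
  ; cocycle = λ x y z w ((x≢y , y≢z , x≢z) , x≢w , y≢w , z≢w) →
      cocycle G _ _ _ _ (Distinct3-map f f-inj (x≢y , y≢z , x≢z) , ≢-map x≢w , ≢-map y≢w , ≢-map z≢w) }
  where
  ≢-map : ∀ {i j} → i ≢ j → f i ≢ f j
  ≢-map i≢j e = i≢j (f-inj _ _ e)

Antisymmetric : ∀ {m} → (Fin m → Fin m → Sign) → Set
Antisymmetric W = ∀ a b → a ≢ b → W b a ≡ opposite (W a b)

coboundary : ∀ {m} → (Fin m → Fin m → Sign) → Fin m → Fin m → Fin m → Sign
coboundary W x y z = (W x y · W y z) · W x z

coboundaryTwoGraph : ∀ {m} (W : Fin m → Fin m → Sign) → Antisymmetric W → OrientedTwoGraph m
coboundaryTwoGraph W anti = record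
  { g       = coboundary W
  ; swap₁₂  = λ { x y z (x≢y , _ , _) →
      trans (cong (λ t → (t · W x z) · W y z) (anti x y x≢y)) (sign-swap₁₂ (W x y) (W y z) (W x z)) }
  ; swap₂₃  = λ { x y z (_ , y≢z , _) →
      trans (cong (λ t → (W x z · t) · W x y) (anti y z y≢z)) (sign-swap₂₃ (W x y) (W y z) (W x z)) }
  ; swap₁₃  = λ { x y z (x≢y , y≢z , x≢z) →
      trans (cong₂ (λ t u → (t · u) · W z x) (anti y z y≢z) (anti x y x≢y))
            (trans (cong (λ t → (opposite (W y z) · opposite (W x y)) · t) (anti x z x≢z))
                   (sign-swap₁₃ (W x y) (W y z) (W x z))) }
  ; cocycle = λ { x y z w ((x≢y , y≢z , _) , _) →
      trans (cong₂ (λ t u → ((coboundary W x y z · ((t · W x w) · W y w)) · ((u · W y w) · W z w)) · coboundary W x z w)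
                   (anti x y x≢y) (anti y z y≢z))
            (sign-cocycle (W x y) (W y z) (W x z) (W x w) (W y w) (W z w)) } }

module _ {n} (G : OrientedTwoGraph n) where

  g-rotate : ∀ x y z → Distinct3 x y z → g G y z x ≡ g G x y z
  g-rotate x y z (x≢y , y≢z , x≢z) = begin
    g G y z x            ≡⟨ swap₂₃ G y x z (≢-sym x≢y , x≢z , y≢z) ⟩
    opposite (g G y x z) ≡⟨ cong opposite (swap₁₂ G x y z (x≢y , y≢z , x≢z)) ⟩
    opposite (opposite (g G x y z)) ≡⟨ Sign.opposite-involutive (g G x y z) ⟩
    g G x y z            ∎
    where open ≡-Reasoning

  g-through : ∀ x y z w → Distinct4 x y z w → g G x y z ≡ (g G y x w · g G z y w) · g G x z w
  g-through x y z w d = sign-solve-cocycle _ _ _ _ (cocycle G x y z w d)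

twoGraphs-agree : ∀ {n} (G H : OrientedTwoGraph n) (w : Fin n) →
  (∀ y z → Distinct3 y z w → g G y z w ≡ g H y z w) →
  ∀ x y z → Distinct3 x y z → g G x y z ≡ g H x y z
twoGraphs-agree G H w agree x y z d@(x≢y , y≢z , x≢z) with x Fin.≟ w | y Fin.≟ w | z Fin.≟ w
... | yes refl | _ | _ = trans (sym (g-rotate G x y z d)) (trans (agree y z (y≢z , ≢-sym x≢z , ≢-sym x≢y)) (g-rotate H x y z d))
... | no _ | yes refl | _ = trans (g-rotate G z x y (≢-sym x≢z , x≢y , ≢-sym y≢z))
                              (trans (agree z x (≢-sym x≢z , x≢y , ≢-sym y≢z)) (sym (g-rotate H z x y (≢-sym x≢z , x≢y , ≢-sym y≢z))))
... | no _ | no _ | yes refl = agree x y d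
... | no x≢w | no y≢w | no z≢w = begin
  g G x y z                                 ≡⟨ g-through G x y z w (d , x≢w , y≢w , z≢w) ⟩
  (g G y x w · g G z y w) · g G x z w       ≡⟨ cong₂ _·_ (cong₂ _·_ (agree y x (≢-sym x≢y , x≢w , y≢w)) (agree z y (≢-sym y≢z , y≢w , z≢w)))
                                                         (agree x z (x≢z , z≢w , x≢w)) ⟩
  (g H y x w · g H z y w) · g H x z w       ≡⟨ g-through H x y z w (d , x≢w , y≢w , z≢w) ⟨
  g H x y z                                 ∎
  where open ≡-Reasoning

-- The oriented two-graph of a graph

orderSign : ∀ {n} → Fin n → Fin n → Sign
orderSign zero    zero    = Sign.-
orderSign zero    (suc _) = Sign.+
orderSign (suc _) zero    = Sign.-
orderSign (suc i) (suc j) = orderSign i j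

orderSign-antisym : ∀ {n} → Antisymmetric (orderSign {n})
orderSign-antisym zero    zero    0≢0 = ⊥-elim (0≢0 refl)
orderSign-antisym zero    (suc b) _   = refl
orderSign-antisym (suc a) zero    _   = refl
orderSign-antisym (suc a) (suc b) a≢b = orderSign-antisym a b (a≢b ∘ cong suc)

orderSign-embed : ∀ {n} (A : Vec Bool n) a b → orderSign (embed A a) (embed A b) ≡ orderSign a b
orderSign-embed (true ∷ A)  zero    zero    = refl
orderSign-embed (true ∷ A)  zero    (suc b) = refl
orderSign-embed (true ∷ A)  (suc a) zero    = refl
orderSign-embed (true ∷ A)  (suc a) (suc b) = orderSign-embed A a b
orderSign-embed (false ∷ A) a       b       = orderSign-embed A a b

edgeSign : Bool → Sign
edgeSign true  = Sign.-
edgeSign false = Sign.+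

signing : ∀ {n} → Graph n → Fin n → Fin n → Sign
signing X a b = orderSign a b · edgeSign (adjacent X a b)

signing-antisym : ∀ {n} (X : Graph n) → Antisymmetric (signing X)
signing-antisym X a b a≢b rewrite orderSign-antisym a b a≢b | adjacent-sym X a b =
  opposite-· (orderSign a b) (edgeSign (adjacent X a b))

twoGraph : ∀ {n} → Graph n → OrientedTwoGraph n
twoGraph X = coboundaryTwoGraph (signing X) (signing-antisym X)

signing-restrict : ∀ {n} (X : Graph n) (A : Vec Bool n) a b →
                   signing (restrict X A) a b ≡ signing X (embed A a) (embed A b)
signing-restrict X A a b = cong₂ _·_ (sym (orderSign-embed A a b)) (cong edgeSign (adjacent-restrict X A a b))

twoGraph-restrict : ∀ {n} (X : Graph n) (A : Vec Bool n) x y z →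
                    g (twoGraph (restrict X A)) x y z ≡ g (twoGraph X) (embed A x) (embed A y) (embed A z)
twoGraph-restrict X A x y z
  rewrite signing-restrict X A x y | signing-restrict X A y z | signing-restrict X A x z = refl

fromAdjacency : ∀ {k} → (Fin k → Fin k → Bool) → Graph k
fromAdjacency {zero}  a = tt
fromAdjacency {suc k} a = tabulate (λ j → a zero (suc j)) , fromAdjacency (λ i j → a (suc i) (suc j))

adjacent-fromAdjacency : ∀ {k} (a : Fin k → Fin k → Bool) → (∀ i j → i ≢ j → a j i ≡ a i j) →
                         ∀ i j → i ≢ j → adjacent (fromAdjacency a) i j ≡ a i j
adjacent-fromAdjacency {suc k} a sym-a zero    zero    0≢0 = ⊥-elim (0≢0 refl)
adjacent-fromAdjacency {suc k} a sym-a zero    (suc j) _   = Vec.lookup∘tabulate _ j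
adjacent-fromAdjacency {suc k} a sym-a (suc i) zero    i≢0 = trans (Vec.lookup∘tabulate _ i) (sym-a (suc i) zero i≢0)
adjacent-fromAdjacency {suc k} a sym-a (suc i) (suc j) i≢j =
  adjacent-fromAdjacency (λ i j → a (suc i) (suc j)) (λ i j i≢j → sym-a (suc i) (suc j) (i≢j ∘ Fin.suc-injective))
                         i j (i≢j ∘ cong suc)

signBit : Sign → Bool
signBit Sign.- = true
signBit Sign.+ = false

edgeSign-signBit : ∀ s → edgeSign (signBit s) ≡ s
edgeSign-signBit Sign.- = refl
edgeSign-signBit Sign.+ = refl

ofSigning : ∀ {k} → (Fin k → Fin k → Sign) → Graph k
ofSigning W = fromAdjacency (λ i j → signBit (orderSign i j · W i j))

signing-ofSigning : ∀ {k} (W : Fin k → Fin k → Sign) → Antisymmetric W →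
                    ∀ i j → i ≢ j → signing (ofSigning W) i j ≡ W i j
signing-ofSigning W anti i j i≢j = begin
  orderSign i j · edgeSign (adjacent (ofSigning W) i j)          ≡⟨ cong (λ b → orderSign i j · edgeSign b) (adjacent-fromAdjacency _ symmetric i j i≢j) ⟩
  orderSign i j · edgeSign (signBit (orderSign i j · W i j))     ≡⟨ cong (orderSign i j ·_) (edgeSign-signBit _) ⟩
  orderSign i j · (orderSign i j · W i j)                        ≡⟨ ·-self-cancel (orderSign i j) (W i j) ⟩
  W i j                                                          ∎
  where
  open ≡-Reasoning
  symmetric : ∀ i j → i ≢ j → signBit (orderSign j i · W j i) ≡ signBit (orderSign i j · W i j)
  symmetric i j i≢j rewrite orderSign-antisym i j i≢j | anti i j i≢j = cong signBit (opposite-·-opposite (orderSign i j) (W i j))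

-- The row of vertex 0 is free; the rest of the graph is forced by G on the triples through 0.
module Realisation {k} (G : OrientedTwoGraph (suc k)) (row : Vec Bool k) where

  private
    e : Fin k → Sign
    e j = edgeSign (lookup row j)

    inner : Fin k → Fin k → Sign
    inner i j = g G (suc i) (suc j) zero · (e i · e j)

    inner-antisym : Antisymmetric inner
    inner-antisym i j i≢j =
      trans (cong (_· (e j · e i)) (swap₁₂ G (suc i) (suc j) zero (i≢j ∘ Fin.suc-injective , (λ ()) , (λ ()))))
            (opposite-·-swap (g G (suc i) (suc j) zero) (e i) (e j))

  realisation : Graph (suc k)
  realisation = row , ofSigning inner

  twoGraph-realisation : ∀ x y z → Distinct3 x y z → g (twoGraph realisation) x y z ≡ g G x y z
  twoGraph-realisation = twoGraphs-agree (twoGraph realisation) G zero through-zero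
    where
    through-zero : ∀ y z → Distinct3 y z zero → g (twoGraph realisation) y z zero ≡ g G y z zero
    through-zero zero    _       (_ , _ , 0≢0) = ⊥-elim (0≢0 refl)
    through-zero (suc i) zero    (_ , 0≢0 , _) = ⊥-elim (0≢0 refl)
    through-zero (suc i) (suc j) (i≢j , _ , _) =
      trans (cong (λ s → (s · opposite (e j)) · opposite (e i)) (signing-ofSigning inner inner-antisym i j (i≢j ∘ cong suc)))
            (·-cancel-twice (g G (suc i) (suc j) zero) (e i) (e j))

-- Counting injections

injective⇒surjective : ∀ {n} (f : Fin n → Fin n) → Injective f → ∀ y → ∃ λ x → f x ≡ y
injective⇒surjective {suc n} f f-inj y with Fin.any? (λ x → f x Fin.≟ y)
... | yes hit = hit
... | no miss = ⊥-elim (1+n≰n (Fin.injective⇒≤ {f = squeeze} λ {x} {x′} e →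
                  f-inj x x′ (Fin.punchOut-injective (missed x) (missed x′) e)))
  where
  missed : ∀ x → y ≢ f x
  missed x e = miss (x , sym e)
  squeeze : Fin (suc n) → Fin n
  squeeze x = punchOut (missed x)

lookup-ext : ∀ {A : Set} {k} (v w : Vec A k) → (∀ i → lookup v i ≡ lookup w i) → v ≡ w
lookup-ext v w v≗w = trans (sym (Vec.tabulate∘lookup v)) (trans (Vec.tabulate-cong v≗w) (Vec.tabulate∘lookup w))

injective? : ∀ {k n} (v : Vec (Fin n) k) → Dec (Injective (lookup v))
injective? v = Fin.all? (λ i → Fin.all? (λ j → (lookup v i Fin.≟ lookup v j) →-dec (i Fin.≟ j)))

module Maps k n = Sum (Vec-summable (Fin-summable n) k)

injectionCount : ℕ → ℕ → ℕ
injectionCount k n = Maps.∑ k n (λ v → 𝟙 (injective? v))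

cons-punchIn-injective : ∀ {k n} (i : Fin (suc n)) (w : Vec (Fin n) k) →
                         Injective (lookup w) → Injective (lookup (i ∷ map (punchIn i) w))
cons-punchIn-injective i w w-inj zero    zero    _ = refl
cons-punchIn-injective i w w-inj zero    (suc b) e = ⊥-elim (Fin.punchInᵢ≢i i (lookup w b) (sym (trans e (Vec.lookup-map b (punchIn i) w))))
cons-punchIn-injective i w w-inj (suc a) zero    e = ⊥-elim (Fin.punchInᵢ≢i i (lookup w a) (trans (sym (Vec.lookup-map a (punchIn i) w)) e))
cons-punchIn-injective i w w-inj (suc a) (suc b) e = cong suc (w-inj a b (Fin.punchIn-injective i _ _
  (trans (sym (Vec.lookup-map a (punchIn i) w)) (trans e (Vec.lookup-map b (punchIn i) w)))))

map-punchIn-injective : ∀ {k n} (i : Fin (suc n)) (w w′ : Vec (Fin n) k) → map (punchIn i) w ≡ map (punchIn i) w′ → w ≡ w′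
map-punchIn-injective i w w′ e = lookup-ext w w′ λ j →
  Fin.punchIn-injective i _ _ (trans (sym (Vec.lookup-map j (punchIn i) w)) (trans (cong (λ v → lookup v j) e) (Vec.lookup-map j (punchIn i) w′)))

-- Each injection Fin k → Fin n extends to injections Fin (suc k) → Fin (suc n), one per value at 0.
injectionCount-suc : ∀ k n → suc n * injectionCount k n ≤ injectionCount (suc k) (suc n)
injectionCount-suc k n = begin
  suc n * injectionCount k n                            ≡⟨ cong (_* injectionCount k n) (∑-Fin-1 (suc n)) ⟨
  ∑-Fin (suc n) (λ _ → 1) * injectionCount k n          ≡⟨ *-comm (∑-Fin (suc n) (λ _ → 1)) (injectionCount k n) ⟩
  injectionCount k n * ∑-Fin (suc n) (λ _ → 1)          ≡⟨ Sum.∑-const (Fin-summable (suc n)) (injectionCount k n) ⟨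
  ∑-Fin (suc n) (λ _ → injectionCount k n)              ≤⟨ Sum.∑-mono-≤ (Fin-summable (suc n)) (λ i →
     count-≤-injection (Vec-summable (Fin-summable n) k) (Vec-summable (Fin-summable (suc n)) k)
       injective? (λ w → injective? (i ∷ w)) (map (punchIn i)) (cons-punchIn-injective i)
       (λ w w′ _ _ → map-punchIn-injective i w w′)) ⟩
  injectionCount (suc k) (suc n)                        ∎
  where
  open ≤-Reasoning
  ∑-Fin-1 : ∀ n → ∑-Fin n (λ _ → 1) ≡ n
  ∑-Fin-1 zero    = refl
  ∑-Fin-1 (suc n) = cong suc (∑-Fin-1 n)

n!≤injectionCount : ∀ n → n ! ≤ injectionCount n n
n!≤injectionCount zero    = s≤s z≤n
n!≤injectionCount (suc n) = ≤-trans (*-monoʳ-≤ (suc n) (n!≤injectionCount n)) (injectionCount-suc n n)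

module Inverse {n} (f : Fin n → Fin n) (f-inj : Injective f) where

  inverse : Fin n → Fin n
  inverse y = proj₁ (injective⇒surjective f f-inj y)

  f∘inverse : ∀ y → f (inverse y) ≡ y
  f∘inverse y = proj₂ (injective⇒surjective f f-inj y)

  inverse∘f : ∀ x → inverse (f x) ≡ x
  inverse∘f x = f-inj _ _ (f∘inverse (f x))

  inverse-injective : Injective inverse
  inverse-injective a b e = trans (sym (f∘inverse a)) (trans (cong f e) (f∘inverse b))

-- Graphs whose oriented two-graph is a copy of G

module Copies {r′} (G : OrientedTwoGraph (suc r′)) where

  r : ℕ
  r = suc r′

  Preserves : ∀ {k} → Graph k → (Fin r → Fin k) → Set
  Preserves H f = ∀ x y z → Distinct3 x y z → g (twoGraph H) (f x) (f y) (f z) ≡ g G x y z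

  IsIsomorphism : ∀ {k} → Graph k → Vec (Fin k) r → Set
  IsIsomorphism H σ = Injective (lookup σ) × Preserves H (lookup σ)

  -- Opaque: no proof needs to compute these decisions, and unfolding them is expensive.
  opaque
    isomorphism? : ∀ {k} (H : Graph k) σ → Dec (IsIsomorphism H σ)
    isomorphism? H σ = injective? σ ×-dec
      Fin.all? (λ x → Fin.all? (λ y → Fin.all? (λ z →
        (¬? (x Fin.≟ y) ×-dec (¬? (y Fin.≟ z) ×-dec ¬? (x Fin.≟ z)))
        →-dec (g (twoGraph H) (lookup σ x) (lookup σ y) (lookup σ z) Sign.≟ g G x y z))))

    isomorphic? : ∀ {k} (H : Graph k) → Dec (∃ (IsIsomorphism H))
    isomorphic? {k} H = Maps.any? r k (isomorphism? H)

  automorphismCount : ℕ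
  automorphismCount = Maps.∑ r r (λ τ → 𝟙 (isAut? G τ))

  -- The isomorphisms onto H form a coset σ₀ ∘ Aut(G).
  isomorphismCount≤automorphismCount : (H : Graph r) (σ₀ : Vec (Fin r) r) → IsIsomorphism H σ₀ →
    Maps.∑ r r (λ σ → 𝟙 (isomorphism? H σ)) ≤ automorphismCount
  isomorphismCount≤automorphismCount H σ₀ (σ₀-inj , σ₀-preserves) =
    count-≤-injection (Vec-summable (Fin-summable r) r) (Vec-summable (Fin-summable r) r)
      (isomorphism? H) (isAut? G) ψ ψ-automorphism (λ σ σ′ _ _ → ψ-injective σ σ′)
    where
    open Inverse (lookup σ₀) σ₀-inj
    ψ : Vec (Fin r) r → Vec (Fin r) r
    ψ σ = tabulate (inverse ∘ lookup σ)
    σ₀∘ψ : ∀ σ i → lookup σ₀ (lookup (ψ σ) i) ≡ lookup σ i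
    σ₀∘ψ σ i = trans (cong (lookup σ₀) (Vec.lookup∘tabulate (inverse ∘ lookup σ) i)) (f∘inverse (lookup σ i))
    ψ-injective : ∀ σ σ′ → ψ σ ≡ ψ σ′ → σ ≡ σ′
    ψ-injective σ σ′ e = lookup-ext σ σ′ λ i →
      trans (sym (σ₀∘ψ σ i)) (trans (cong (λ v → lookup σ₀ (lookup v i)) e) (σ₀∘ψ σ′ i))
    ψ-automorphism : ∀ σ → IsIsomorphism H σ → IsAut G (ψ σ)
    ψ-automorphism σ (σ-inj , σ-preserves) = ψσ-inj , ψσ-preserves
      where
      ψσ-inj : Injective (lookup (ψ σ))
      ψσ-inj i j e = σ-inj i j (trans (sym (σ₀∘ψ σ i)) (trans (cong (lookup σ₀) e) (σ₀∘ψ σ j)))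
      ψσ-preserves : ∀ x y z → Distinct3 x y z → g G (lookup (ψ σ) x) (lookup (ψ σ) y) (lookup (ψ σ) z) ≡ g G x y z
      ψσ-preserves x y z d = begin
        g G (lookup (ψ σ) x) (lookup (ψ σ) y) (lookup (ψ σ) z)
          ≡⟨ σ₀-preserves _ _ _ (Distinct3-map (lookup (ψ σ)) ψσ-inj d) ⟨
        g (twoGraph H) (lookup σ₀ (lookup (ψ σ) x)) (lookup σ₀ (lookup (ψ σ) y)) (lookup σ₀ (lookup (ψ σ) z))
          ≡⟨ cong₂ (λ a b → g (twoGraph H) a b _) (σ₀∘ψ σ x) (σ₀∘ψ σ y) ⟩
        g (twoGraph H) (lookup σ x) (lookup σ y) (lookup σ₀ (lookup (ψ σ) z))
          ≡⟨ cong (g (twoGraph H) (lookup σ x) (lookup σ y)) (σ₀∘ψ σ z) ⟩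
        g (twoGraph H) (lookup σ x) (lookup σ y) (lookup σ z)
          ≡⟨ σ-preserves x y z d ⟩
        g G x y z ∎
        where open ≡-Reasoning

  -- Realise G relabelled along σ⁻¹, once for every row of vertex 0.
  rowCount≤isomorphicGraphs : ∀ σ → Injective (lookup σ) → rowCount r′ ≤ Gr.∑ r (λ H → 𝟙 (isomorphism? H σ))
  rowCount≤isomorphicGraphs σ σ-inj = Row.∑-mono-≤ r′ λ row →
    ≤-trans (≤-reflexive (sym (𝟙-yes (isomorphism? (realisation row) σ) (σ-inj , preserves row))))
            (Sum.F≤∑F (Graph-summable r′) (λ X → 𝟙 (isomorphism? (row , X) σ)) (proj₂ (realisation row)))
    where
    open Inverse (lookup σ) σ-inj
    open Realisation (relabel inverse inverse-injective G)
    preserves : ∀ row → Preserves (realisation row) (lookup σ)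
    preserves row x y z d = begin
      g (twoGraph (realisation row)) (lookup σ x) (lookup σ y) (lookup σ z)
        ≡⟨ twoGraph-realisation row _ _ _ (Distinct3-map (lookup σ) σ-inj d) ⟩
      g G (inverse (lookup σ x)) (inverse (lookup σ y)) (inverse (lookup σ z))
        ≡⟨ cong₂ (λ a b → g G a b (inverse (lookup σ z))) (inverse∘f x) (inverse∘f y) ⟩
      g G x y (inverse (lookup σ z))
        ≡⟨ cong (g G x y) (inverse∘f z) ⟩
      g G x y z ∎
      where open ≡-Reasoning

  isomorphismCount-bound : ∀ H → Maps.∑ r r (λ σ → 𝟙 (isomorphism? H σ)) ≤ automorphismCount * 𝟙 (isomorphic? H)
  isomorphismCount-bound H = bound (isomorphic? H)
    where
    bound : (d : Dec (∃ (IsIsomorphism H))) → Maps.∑ r r (λ σ → 𝟙 (isomorphism? H σ)) ≤ automorphismCount * 𝟙 d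
    bound (yes (σ₀ , iso)) = ≤-trans (isomorphismCount≤automorphismCount H σ₀ iso) (≤-reflexive (sym (*-identityʳ _)))
    bound (no ∄iso)        = ≤-reflexive (trans (Maps.∑-zero r r (λ σ → 𝟙-no (isomorphism? H σ) (λ iso → ∄iso (σ , iso))))
                                                (sym (*-zeroʳ automorphismCount)))

  r!*rowCount≤ : r ! * rowCount r′ ≤ automorphismCount * Gr.∑ r (λ H → 𝟙 (isomorphic? H))
  r!*rowCount≤ = begin
    r ! * rowCount r′                                            ≤⟨ *-monoˡ-≤ (rowCount r′) (n!≤injectionCount r) ⟩
    injectionCount r r * rowCount r′                             ≡⟨ Maps.∑-*ʳ r r (rowCount r′) (λ σ → 𝟙 (injective? σ)) ⟨
    Maps.∑ r r (λ σ → 𝟙 (injective? σ) * rowCount r′)            ≤⟨ Maps.∑-mono-≤ r r injective⇒realisable ⟩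
    Maps.∑ r r (λ σ → Gr.∑ r (λ H → 𝟙 (isomorphism? H σ)))       ≡⟨ Gr.fubini r (Maps.∑ r r) (Maps.linear r r) (λ H σ → 𝟙 (isomorphism? H σ)) ⟨
    Gr.∑ r (λ H → Maps.∑ r r (λ σ → 𝟙 (isomorphism? H σ)))       ≤⟨ Gr.∑-mono-≤ r isomorphismCount-bound ⟩
    Gr.∑ r (λ H → automorphismCount * 𝟙 (isomorphic? H))         ≡⟨ Gr.∑-*ˡ r automorphismCount _ ⟩
    automorphismCount * Gr.∑ r (λ H → 𝟙 (isomorphic? H))         ∎
    where
    open ≤-Reasoning
    injective⇒realisable : ∀ σ → 𝟙 (injective? σ) * rowCount r′ ≤ Gr.∑ r (λ H → 𝟙 (isomorphism? H σ))
    injective⇒realisable σ = realisable (injective? σ)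
      where
      realisable : (d : Dec (Injective (lookup σ))) → 𝟙 d * rowCount r′ ≤ Gr.∑ r (λ H → 𝟙 (isomorphism? H σ))
      realisable (yes σ-inj) = ≤-trans (≤-reflexive (+-identityʳ (rowCount r′))) (rowCount≤isomorphicGraphs σ σ-inj)
      realisable (no _)      = z≤n

  copyDensity : r ! * graphCount r ≤ automorphismCount * 2 ^ (r′ C 2) * Gr.∑ r (λ H → 𝟙 (isomorphic? H))
  copyDensity = begin
    r ! * graphCount r                             ≡⟨ cong (r ! *_) (trans (graphCount-suc r′) (cong (_* rowCount r′) (graphCount≡2^[nC2] r′))) ⟩
    r ! * (2 ^ (r′ C 2) * rowCount r′)             ≡⟨ x∙yz≈y∙xz (r !) (2 ^ (r′ C 2)) (rowCount r′) ⟩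
    2 ^ (r′ C 2) * (r ! * rowCount r′)             ≤⟨ *-monoʳ-≤ (2 ^ (r′ C 2)) r!*rowCount≤ ⟩
    2 ^ (r′ C 2) * (automorphismCount * copies)    ≡⟨ x∙yz≈yx∙z (2 ^ (r′ C 2)) automorphismCount copies ⟩
    automorphismCount * 2 ^ (r′ C 2) * copies      ∎
    where
    open ≤-Reasoning
    copies : ℕ
    copies = Gr.∑ r (λ H → 𝟙 (isomorphic? H))

-- Sums over the enumerations used in the statement

listSum : ∀ {A : Set} → List A → (A → ℕ) → ℕ
listSum []       F = 0
listSum (x ∷ xs) F = F x + listSum xs F

listSum-cong : ∀ {A : Set} (xs : List A) {F G : A → ℕ} → (∀ x → F x ≡ G x) → listSum xs F ≡ listSum xs G
listSum-cong []       _   = refl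
listSum-cong (x ∷ xs) F≡G = cong₂ _+_ (F≡G x) (listSum-cong xs F≡G)

listSum-++ : ∀ {A : Set} (xs ys : List A) (F : A → ℕ) → listSum (xs ++ ys) F ≡ listSum xs F + listSum ys F
listSum-++ []       ys F = refl
listSum-++ (x ∷ xs) ys F = trans (cong (F x +_) (listSum-++ xs ys F)) (sym (+-assoc (F x) _ _))

listSum-map : ∀ {A B : Set} (f : A → B) (xs : List A) (F : B → ℕ) → listSum (List.map f xs) F ≡ listSum xs (F ∘ f)
listSum-map f []       F = refl
listSum-map f (x ∷ xs) F = cong (F (f x) +_) (listSum-map f xs F)

listSum-concatMap : ∀ {A B : Set} (f : A → List B) (xs : List A) (F : B → ℕ) →
                    listSum (concatMap f xs) F ≡ listSum xs (λ x → listSum (f x) F)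
listSum-concatMap f []       F = refl
listSum-concatMap f (x ∷ xs) F =
  trans (listSum-++ (f x) (concat (List.map f xs)) F) (cong (listSum (f x) F +_) (listSum-concatMap f xs F))

length-filter : ∀ {A : Set} {P : A → Set} (P? : ∀ x → Dec (P x)) (xs : List A) →
                length (filter P? xs) ≡ listSum xs (λ x → 𝟙 (P? x))
length-filter P? []       = refl
length-filter P? (x ∷ xs) with P? x
... | yes _ = cong suc (length-filter P? xs)
... | no _  = length-filter P? xs

listSum-tabulate : ∀ {A : Set} n (f : Fin n → A) (F : A → ℕ) → listSum (List.tabulate f) F ≡ ∑-Fin n (F ∘ f)
listSum-tabulate zero    f F = refl
listSum-tabulate (suc n) f F = cong (F (f zero) +_) (listSum-tabulate n (f ∘ suc) F)

listSum-allVecs : ∀ k n (F : Vec (Fin n) k → ℕ) → listSum (allVecs k n) F ≡ Maps.∑ k n F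
listSum-allVecs zero    n F = refl
listSum-allVecs (suc k) n F = begin
  listSum (concatMap (λ i → List.map (i ∷_) (allVecs k n)) (allFin n)) F   ≡⟨ listSum-concatMap _ (allFin n) F ⟩
  listSum (allFin n) (λ i → listSum (List.map (i ∷_) (allVecs k n)) F)     ≡⟨ listSum-cong (allFin n) (λ i → listSum-map (i ∷_) (allVecs k n) F) ⟩
  listSum (allFin n) (λ i → listSum (allVecs k n) (F ∘ (i ∷_)))             ≡⟨ listSum-cong (allFin n) (λ i → listSum-allVecs k n (F ∘ (i ∷_))) ⟩
  listSum (allFin n) (λ i → Maps.∑ k n (F ∘ (i ∷_)))                        ≡⟨ listSum-tabulate n (λ i → i) _ ⟩
  Maps.∑ (suc k) n F                                                        ∎
  where open ≡-Reasoning

listSum-allSubsets : ∀ n (F : Vec Bool n → ℕ) → listSum (allSubsets n) F ≡ Row.∑ n F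
listSum-allSubsets zero    F = refl
listSum-allSubsets (suc n) F = begin
  listSum (allSubsets (suc n)) F                                           ≡⟨ listSum-concatMap _ (allSubsets n) F ⟩
  listSum (allSubsets n) (λ A → F (true ∷ A) + (F (false ∷ A) + 0))        ≡⟨ listSum-allSubsets n _ ⟩
  Row.∑ n (λ A → F (true ∷ A) + (F (false ∷ A) + 0))                       ≡⟨ Row.∑-+ n _ _ ⟩
  Row.∑ n (F ∘ (true ∷_)) + Row.∑ n (λ A → F (false ∷ A) + 0)              ≡⟨ cong (Row.∑ n (F ∘ (true ∷_)) +_) (Row.∑-+ n _ _) ⟩
  Row.∑ n (F ∘ (true ∷_)) + (Row.∑ n (F ∘ (false ∷_)) + Row.∑ n (λ _ → 0)) ≡⟨ cong (λ z → Row.∑ n (F ∘ (true ∷_)) + (Row.∑ n (F ∘ (false ∷_)) + z)) (Row.∑-0 n) ⟩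
  Row.∑ (suc n) F                                                          ∎
  where open ≡-Reasoning

subsetCount : ∀ n k → Row.∑ n (λ A → 𝟙 (size A ℕ.≟ k)) ≡ n C k
subsetCount zero    zero    = refl
subsetCount zero    (suc k) = refl
subsetCount (suc n) zero    = begin
  Row.∑ n (λ A → 𝟙 (suc (size A) ℕ.≟ 0)) + (Row.∑ n (λ A → 𝟙 (size A ℕ.≟ 0)) + 0) ≡⟨ cong₂ _+_ (Row.∑-zero n (λ A → 𝟙-no (suc (size A) ℕ.≟ 0) λ ())) (+-identityʳ _) ⟩
  Row.∑ n (λ A → 𝟙 (size A ℕ.≟ 0))                                                 ≡⟨ subsetCount n zero ⟩
  1                                                                               ∎
  where open ≡-Reasoning
subsetCount (suc n) (suc k) = begin
  Row.∑ n (λ A → 𝟙 (suc (size A) ℕ.≟ suc k)) + (Row.∑ n (λ A → 𝟙 (size A ℕ.≟ suc k)) + 0)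
    ≡⟨ cong₂ _+_ (Row.∑-cong n (λ A → 𝟙-cong (suc (size A) ℕ.≟ suc k) (size A ℕ.≟ k) suc-injective (cong suc))) (+-identityʳ _) ⟩
  Row.∑ n (λ A → 𝟙 (size A ℕ.≟ k)) + Row.∑ n (λ A → 𝟙 (size A ℕ.≟ suc k))
    ≡⟨ cong₂ _+_ (subsetCount n k) (subsetCount n (suc k)) ⟩
  n C k + n C suc k
    ≡⟨ nCk+nC[k+1]≡[n+1]C[k+1] n k ⟩
  suc n C suc k ∎
  where open ≡-Reasoning

-- The hypergraph of copies of G

does-true : ∀ {A : Set} (d : Dec A) → does d ≡ true → A
does-true (yes a) _ = a

subsetOf : ∀ {n} {P : Fin n → Set} → (∀ v → Dec (P v)) → Subset n
subsetOf P? = tabulate (does ∘ P?)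

∈-subsetOf : ∀ {n} {P : Fin n → Set} (P? : ∀ v → Dec (P v)) v → v ∈ subsetOf P? ⇔ P v
∈-subsetOf P? v = mk⇔
  (λ v∈ → does-true (P? v) (trans (sym (Vec.lookup∘tabulate (does ∘ P?) v)) (Vec.[]=⇒lookup v∈)))
  (λ pv → Vec.lookup⇒[]= v (subsetOf P?) (trans (Vec.lookup∘tabulate (does ∘ P?) v) (dec-true (P? v) pv)))

∈∁⁅⁆⇔≢ : ∀ {n} {u v : Fin n} → v ∈ ∁ ⁅ u ⁆ ⇔ v ≢ u
∈∁⁅⁆⇔≢ = mk⇔ (λ v∈ v≡u → x∈∁p⇒x∉p v∈ (Equivalence.from x∈⁅y⁆⇔x≡y v≡u)) (λ v≢u → x∉p⇒x∈∁p (v≢u ∘ Equivalence.to x∈⁅y⁆⇔x≡y))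

∁⁅⁆-injective : ∀ {n} {u u′ : Fin n} → ∁ ⁅ u ⁆ ≡ ∁ ⁅ u′ ⁆ → u ≡ u′
∁⁅⁆-injective {u = u} {u′} e with u Fin.≟ u′
... | yes u≡u′ = u≡u′
... | no  u≢u′ = ⊥-elim (Equivalence.to ∈∁⁅⁆⇔≢ (subst (u ∈_) (sym e) (Equivalence.from ∈∁⁅⁆⇔≢ u≢u′)) refl)

module CopyHypergraph {r′} (G : OrientedTwoGraph (suc r′)) where
  open Copies G public

  IsCopy : ∀ {k} → Graph k → Set
  IsCopy {k} H = k ≡ r × ∃ (IsIsomorphism H)

  copy? : ∀ {k} (H : Graph k) → Dec (IsCopy H)
  copy? {k} H = (k ℕ.≟ r) ×-dec isomorphic? H

  Bijection : ∀ {k} → Graph k → Set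
  Bijection {k} H = Σ (Fin r → Fin k) λ f → Injective f × (∀ y → ∃ λ x → f x ≡ y) × Preserves H f

  copy⇒bijection : ∀ {k} (H : Graph k) → IsCopy H → Bijection H
  copy⇒bijection H (refl , σ , σ-inj , σ-preserves) =
    lookup σ , σ-inj , injective⇒surjective (lookup σ) σ-inj , σ-preserves

  copyHypergraph : ∀ {n} → Graph n → UniformHypergraph r n
  copyHypergraph X = record
    { edge    = λ A → does (copy? (restrict X A))
    ; uniform = λ A e → trans (sym (size≡∣∣ A)) (proj₁ (does-true (copy? (restrict X A)) e)) }

  pullback-copy : ∀ {n} (X : Graph n) (f : Fin (suc r) → Fin n) (f-inj : Injective f) u B →
    ImageMinus f u B → Bijection (restrict X B) → RestrIso (relabel f f-inj (twoGraph X)) (∁ ⁅ u ⁆) G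
  pullback-copy X f f-inj u B B≡image (σ , σ-inj , σ-surj , σ-preserves) = ψ , ψ-inj , ψ-image , ψ-preserves
    where
    preimage : ∀ x → ∃ λ k → k ≢ u × f k ≡ embed B (σ x)
    preimage x = Equivalence.to (B≡image (embed B (σ x))) (Vec.lookup⇒[]= _ B (embed-∈ B (σ x)))
    ψ : Fin r → Fin (suc r)
    ψ x = proj₁ (preimage x)
    f∘ψ : ∀ x → f (ψ x) ≡ embed B (σ x)
    f∘ψ x = proj₂ (proj₂ (preimage x))
    ψ-inj : ∀ x y → ψ x ≡ ψ y → x ≡ y
    ψ-inj x y e = σ-inj x y (embed-injective B _ _ (trans (sym (f∘ψ x)) (trans (cong f e) (f∘ψ y))))
    ψ-onto : ∀ v → v ≢ u → ∃ λ x → ψ x ≡ v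
    ψ-onto v v≢u =
      let fv∈B = Equivalence.from (B≡image (f v)) (v , v≢u , refl)
          (j , embed-j≡fv) = embed-onto B (f v) (Vec.[]=⇒lookup fv∈B)
          (x , σx≡j) = σ-surj j
      in x , f-inj _ _ (trans (f∘ψ x) (trans (cong (embed B) σx≡j) embed-j≡fv))
    ψ-image : ∀ v → (v ∈ ∁ ⁅ u ⁆) ⇔ (∃ λ x → ψ x ≡ v)
    ψ-image v = mk⇔ (ψ-onto v ∘ Equivalence.to ∈∁⁅⁆⇔≢)
                    (λ { (x , refl) → Equivalence.from ∈∁⁅⁆⇔≢ (proj₁ (proj₂ (preimage x))) })
    ψ-preserves : ∀ x y z → Distinct3 x y z → g (twoGraph X) (f (ψ x)) (f (ψ y)) (f (ψ z)) ≡ g G x y z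
    ψ-preserves x y z d = begin
      g (twoGraph X) (f (ψ x)) (f (ψ y)) (f (ψ z))                      ≡⟨ cong₂ (λ a b → g (twoGraph X) a b (f (ψ z))) (f∘ψ x) (f∘ψ y) ⟩
      g (twoGraph X) (embed B (σ x)) (embed B (σ y)) (f (ψ z))           ≡⟨ cong (g (twoGraph X) (embed B (σ x)) (embed B (σ y))) (f∘ψ z) ⟩
      g (twoGraph X) (embed B (σ x)) (embed B (σ y)) (embed B (σ z))     ≡⟨ twoGraph-restrict X B (σ x) (σ y) (σ z) ⟨
      g (twoGraph (restrict X B)) (σ x) (σ y) (σ z)                      ≡⟨ σ-preserves x y z d ⟩
      g G x y z                                                          ∎
      where open ≡-Reasoning

  copyHypergraph-HFree : ((H : OrientedTwoGraph (suc r)) → AtMostTwoCopies H G) →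
                         ∀ {n} (X : Graph n) → HFree (copyHypergraph X)
  copyHypergraph-HFree atMostTwo X (f , f-inj , a , b , c , (a≢b , b≢c , a≢c) , edges) =
    atMostTwo H (∁ ⁅ a ⁆) (∁ ⁅ b ⁆) (∁ ⁅ c ⁆) (a≢b ∘ ∁⁅⁆-injective) (b≢c ∘ ∁⁅⁆-injective) (a≢c ∘ ∁⁅⁆-injective)
      (copyAt a (inj₁ refl)) (copyAt b (inj₂ (inj₁ refl))) (copyAt c (inj₂ (inj₂ refl)))
    where
    H : OrientedTwoGraph (suc r)
    H = relabel f f-inj (twoGraph X)
    image : Fin (suc r) → Subset _
    image u = subsetOf (λ v → Fin.any? (λ k → ¬? (k Fin.≟ u) ×-dec (f k Fin.≟ v)))
    image-minus : ∀ u → ImageMinus f u (image u)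
    image-minus u v = ∈-subsetOf (λ v → Fin.any? (λ k → ¬? (k Fin.≟ u) ×-dec (f k Fin.≟ v))) v
    copyAt : ∀ u → u ≡ a ⊎ (u ≡ b ⊎ u ≡ c) → RestrIso H (∁ ⁅ u ⁆) G
    copyAt u u∈abc = pullback-copy X f f-inj u (image u) (image-minus u) (copy⇒bijection _
                       (does-true (copy? (restrict X (image u))) (edges u u∈abc (image u) (image-minus u))))

  q : ℕ
  q = automorphismCount * 2 ^ (r′ C 2)

  copyDensity-sized : ∀ {k} → k ≡ r → r ! * graphCount k ≤ q * Gr.∑ k (λ H → 𝟙 (copy? H))
  copyDensity-sized refl = subst (λ t → r ! * graphCount r ≤ q * t) (Gr.∑-cong r 𝟙-isomorphic≡𝟙-copy) copyDensity
    where
    𝟙-isomorphic≡𝟙-copy : ∀ H → 𝟙 (isomorphic? H) ≡ 𝟙 (copy? H)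
    𝟙-isomorphic≡𝟙-copy H = 𝟙-cong (isomorphic? H) (copy? H) (refl ,_) proj₂

  graphCount-nonZero : ∀ n → NonZero (graphCount n)
  graphCount-nonZero n = subst NonZero (sym (graphCount≡2^[nC2] n)) (m^n≢0 2 (n C 2))

  copiesOn : ∀ {n} (A : Subset n) → r ! * graphCount n * 𝟙 (size A ℕ.≟ r) ≤ q * Gr.∑ n (λ X → 𝟙 (copy? (restrict X A)))
  copiesOn {n} A = bound (size A ℕ.≟ r)
    where
    s : ℕ
    s = size A
    F : Graph s → ℕ
    F H = 𝟙 (copy? H)
    bound : (d : Dec (s ≡ r)) → r ! * graphCount n * 𝟙 d ≤ q * Gr.∑ n (λ X → F (restrict X A))
    bound (no _)    = ≤-trans (≤-reflexive (*-zeroʳ (r ! * graphCount n))) z≤n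
    bound (yes s≡r) = ≤-trans (≤-reflexive (*-identityʳ (r ! * graphCount n))) (*-cancelʳ-≤ _ _ (graphCount s) {{graphCount-nonZero s}} (begin
      r ! * graphCount n * graphCount s                    ≡⟨ xy∙z≈xz∙y (r !) (graphCount n) (graphCount s) ⟩
      r ! * graphCount s * graphCount n                    ≤⟨ *-monoˡ-≤ (graphCount n) (copyDensity-sized s≡r) ⟩
      q * Gr.∑ s F * graphCount n                          ≡⟨ *-assoc q (Gr.∑ s F) (graphCount n) ⟩
      q * (Gr.∑ s F * graphCount n)                        ≡⟨ cong (q *_) (∑-restrict n A F) ⟨
      q * (Gr.∑ n (λ X → F (restrict X A)) * graphCount s) ≡⟨ *-assoc q (Gr.∑ n (λ X → F (restrict X A))) (graphCount s) ⟨
      q * Gr.∑ n (λ X → F (restrict X A)) * graphCount s   ∎))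
      where open ≤-Reasoning

  edgeCount-copyHypergraph : ∀ {n} (X : Graph n) → edgeCount (copyHypergraph X) ≡ Row.∑ n (λ A → 𝟙 (copy? (restrict X A)))
  edgeCount-copyHypergraph {n} X = begin
    edgeCount (copyHypergraph X)                                          ≡⟨ length-filter _ (allSubsets n) ⟩
    listSum (allSubsets n) (λ A → 𝟙 (does (copy? (restrict X A)) Bool.≟ true)) ≡⟨ listSum-allSubsets n _ ⟩
    Row.∑ n (λ A → 𝟙 (does (copy? (restrict X A)) Bool.≟ true))           ≡⟨ Row.∑-cong n (λ A → 𝟙-does (copy? (restrict X A))) ⟩
    Row.∑ n (λ A → 𝟙 (copy? (restrict X A)))                              ∎
    where
    open ≡-Reasoning
    𝟙-does : ∀ {A : Set} (d : Dec A) → 𝟙 (does d Bool.≟ true) ≡ 𝟙 d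
    𝟙-does (yes _) = refl
    𝟙-does (no _)  = refl

  totalEdgeCount : ∀ n → r ! * graphCount n * (n C r) ≤ q * Gr.∑ n (λ X → edgeCount (copyHypergraph X))
  totalEdgeCount n = begin
    r ! * graphCount n * (n C r)                                          ≡⟨ cong (r ! * graphCount n *_) (subsetCount n r) ⟨
    r ! * graphCount n * Row.∑ n (λ A → 𝟙 (size A ℕ.≟ r))                 ≡⟨ Row.∑-*ˡ n (r ! * graphCount n) _ ⟨
    Row.∑ n (λ A → r ! * graphCount n * 𝟙 (size A ℕ.≟ r))                 ≤⟨ Row.∑-mono-≤ n copiesOn ⟩
    Row.∑ n (λ A → q * Gr.∑ n (λ X → 𝟙 (copy? (restrict X A))))           ≡⟨ Row.∑-*ˡ n q _ ⟩
    q * Row.∑ n (λ A → Gr.∑ n (λ X → 𝟙 (copy? (restrict X A))))           ≡⟨ cong (q *_) (Gr.fubini n (Row.∑ n) (Row.linear n) _) ⟨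
    q * Gr.∑ n (λ X → Row.∑ n (λ A → 𝟙 (copy? (restrict X A))))           ≡⟨ cong (q *_) (Gr.∑-cong n (sym ∘ edgeCount-copyHypergraph)) ⟩
    q * Gr.∑ n (λ X → edgeCount (copyHypergraph X))                       ∎
    where open ≤-Reasoning

  denseCopyHypergraph : ∀ n → ∃ λ (X : Graph n) → r ! * (n C r) ≤ q * edgeCount (copyHypergraph X)
  denseCopyHypergraph n = X* , *-cancelʳ-≤ _ _ (graphCount n) {{graphCount-nonZero n}} (begin
    r ! * (n C r) * graphCount n                          ≡⟨ xy∙z≈xz∙y (r !) (n C r) (graphCount n) ⟩
    r ! * graphCount n * (n C r)                          ≤⟨ totalEdgeCount n ⟩
    q * Gr.∑ n (λ X → edgeCount (copyHypergraph X))       ≤⟨ *-monoʳ-≤ q (Gr.∑-mono-≤ n X*-maximal) ⟩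
    q * Gr.∑ n (λ _ → edgeCount (copyHypergraph X*))      ≡⟨ cong (q *_) (Gr.∑-const n _) ⟩
    q * (edgeCount (copyHypergraph X*) * graphCount n)    ≡⟨ *-assoc q _ (graphCount n) ⟨
    q * edgeCount (copyHypergraph X*) * graphCount n      ∎)
    where
    open ≤-Reasoning
    X* : Graph n
    X* = proj₁ (Gr.argmax n (emptyGraph n) (edgeCount ∘ copyHypergraph))
    X*-maximal : ∀ X → edgeCount (copyHypergraph X) ≤ edgeCount (copyHypergraph X*)
    X*-maximal = proj₂ (Gr.argmax n (emptyGraph n) (edgeCount ∘ copyHypergraph))

  -- The bound of denseCopyHypergraph holds for every n.
  copyHypergraph-density : ((H : OrientedTwoGraph (suc r)) → AtMostTwoCopies H G) → TuranDensityAtLeast r (r !) q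
  copyHypergraph-density atMostTwo m =
    0 , λ n _ → copyHypergraph (densest n) , copyHypergraph-HFree atMostTwo (densest n) , scale (proj₂ (denseCopyHypergraph n))
    where
    densest : ∀ n → Graph n
    densest n = proj₁ (denseCopyHypergraph n)
    scale : ∀ {a b c} → r ! * a ≤ q * b → suc m * r ! * a ≤ suc m * q * b + c
    scale {a} {b} {c} r!a≤qb = begin
      suc m * r ! * a    ≡⟨ *-assoc (suc m) (r !) a ⟩
      suc m * (r ! * a)  ≤⟨ *-monoʳ-≤ (suc m) r!a≤qb ⟩
      suc m * (q * b)    ≡⟨ *-assoc (suc m) q b ⟨
      suc m * q * b      ≤⟨ m≤m+n _ c ⟩
      suc m * q * b + c  ∎
      where open ≤-Reasoning

autCount≡automorphismCount : ∀ {r′} (G : OrientedTwoGraph (suc r′)) → autCount G ≡ Copies.automorphismCount G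
autCount≡automorphismCount {r′} G =
  trans (length-filter (isAut? G) (allVecs (suc r′) (suc r′))) (listSum-allVecs (suc r′) (suc r′) _)

proposition4p4 : (r : ℕ) → 2 ≤ r → (G : OrientedTwoGraph r) →
    ((H : OrientedTwoGraph (suc r)) → AtMostTwoCopies H G) →
    TuranDensityAtLeast r (r !) (autCount G * 2 ^ (pred r C 2))
proposition4p4 zero () _ _
proposition4p4 (suc r′) _ G atMostTwo =
  subst (λ a → TuranDensityAtLeast (suc r′) (suc r′ !) (a * 2 ^ (r′ C 2)))
        (sym (autCount≡automorphismCount G))
        (CopyHypergraph.copyHypergraph-density G atMostTwo)
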